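{- Each of the following ten atomic-flow reduction rules is sound: $\mathsf{w}{\downarrow}$-$\mathsf{c}{\downarrow}$, $\mathsf{w}{\downarrow}$-$\mathsf{i}{\uparrow}$, $\mathsf{w}{\downarrow}$-$\mathsf{w}{\uparrow}$, $\mathsf{w}{\downarrow}$-$\mathsf{c}{\uparrow}$, $\mathsf{c}{\downarrow}$-$\mathsf{i}{\uparrow}$, $\mathsf{c}{\downarrow}$-$\mathsf{c}{\uparrow}$, $\mathsf{c}{\uparrow}$-$\mathsf{w}{\uparrow}$, $\mathsf{i}{\downarrow}$-$\mathsf{w}{\uparrow}$, $\mathsf{c}{\downarrow}$-$\mathsf{w}{\uparrow}$ and $\mathsf{i}{\downarrow}$-$\mathsf{c}{\uparrow}$. That is, for each such rule $r$, whenever $C\to_r D$ and $\Phi$ is an $\mathsf{SKS}$ derivation with atomic flow $C$, there is an $\mathsf{SKS}$ derivation $\Psi$ with atomic flow $D$ and the same premiss and conclusion as $\Phi$.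
   Context: $\mathsf{SKS}$: formulae from units $\mathsf f,\mathsf t$, atoms $a$ (involution $a\mapsto\bar a$), disjunction $[\alpha\vee\beta]$, conjunction $(\alpha\wedge\beta)$; inference steps rewrite $\xi\{\alpha\}$ to $\xi\{\beta\}$ in any context $\xi\{\ \}$ for rule instances $\mathsf{ai}{\downarrow}\colon\mathsf t\to[a\vee\bar a]$, $\mathsf{aw}{\downarrow}\colon\mathsf f\to a$, $\mathsf{ac}{\downarrow}\colon[a\vee a]\to a$, $\mathsf{ai}{\uparrow}\colon(a\wedge\bar a)\to\mathsf f$, $\mathsf{aw}{\uparrow}\colon a\to\mathsf t$, $\mathsf{ac}{\uparrow}\colon a\to(a\wedge a)$, switch $(\alpha\wedge[\beta\vee\gamma])\to[(\alpha\wedge\beta)\vee\gamma]$, medial $[(\alpha\wedge\beta)\vee(\gamma\wedge\delta)]\to([\alpha\vee\gamma]\wedge[\beta\vee\delta])$, and $=$ (commutativity/associativity of $\vee,\wedge$, $[\alpha\vee\mathsf f]=\alpha$, $(\alpha\wedge\mathsf t)=\alpha$, $[\mathsf t\vee\mathsf t]=\mathsf t$, $(\mathsf f\wedge\mathsf f)=\mathsf f$). A derivation is a sequence of formulae, consecutive ones related by an inference step; premiss = first, conclusion = last. Atomic flow: finite directed acyclic graph; vertices labelled interaction $\mathsf{ai}{\downarrow}$ (0 upper, 2 lower edges), cointeraction $\mathsf{ai}{\uparrow}$ (2 upper, 0 lower), weakening $\mathsf{aw}{\downarrow}$ (0,1), coweakening $\mathsf{aw}{\uparrow}$ (1,0),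 contraction $\mathsf{ac}{\downarrow}$ (2,1), cocontraction $\mathsf{ac}{\uparrow}$ (1,2); edges may have their upper end at a special top $\top$ (upper edges of the flow) or lower end at a special bottom $\bot$ (lower edges of the flow); there is a polarity assignment $E\to\{+,-\}$ with equal polarities on all edges of a (co)contraction and opposite ones on the two edges of a (co)interaction. The atomic flow of a derivation: edges are atom occurrences traced through the derivation (unchanged through contexts and through switch, medial, $=$), each instance of an atomic structural rule being a vertex with the same label, with upper edges its destroyed and lower edges its created atom occurrences; premiss occurrences are the upper edges, conclusion occurrences the lower edges. Reduction rules (a step $C\to_r D$ replaces a subgraph of $C$ of the left-hand shape by the right-hand shape, keeping boundary edges): $\mathsf{w}{\downarrow}$-$\mathsf{c}{\downarrow}$: a weakening whose lower edge is an upper edge of a contraction: delete both and that edge, merging the contraction's other upper edge with its lower edge; $\mathsf{c}{\uparrow}$-$\mathsf{w}{\uparrow}$: a cocontraction one of whose lower edges is the upper edge of a coweakening: delete both and that edge, merging the cocontraction's upper edge with its other lower edge; $\mathsf{w}{\downarrow}$-$\mathsf{i}{\uparrow}$: a weakening whose lower edge is an upper edge of a cointeraction: delete both and that edge, and the cointeraction's other upper edge becomes the upper edge of a new coweakening; $\mathsf{i}{\downarrow}$-$\mathsf{w}{\uparrow}$: an interaction one of whose lower edges is the upper edge of a coweakening: delete both and that edge, and the other lower edge becomes the lower edge of a new weakening; $\mathsf{w}{\downarrow}$-$\mathsf{w}{\uparrow}$: a weakening whose lower edge is the upper edge of a coweakening: delete both and the edge; $\mathsf{w}{\downarrow}$-$\mathsf{c}{\uparrow}$: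 a weakening whose lower edge is the upper edge of a cocontraction: delete both and that edge, and each lower edge of the cocontraction becomes the lower edge of a new weakening; $\mathsf{c}{\downarrow}$-$\mathsf{w}{\uparrow}$: a contraction whose lower edge is the upper edge of a coweakening: delete both and that edge, and each upper edge of the contraction becomes the upper edge of a new coweakening; $\mathsf{c}{\downarrow}$-$\mathsf{i}{\uparrow}$: a contraction with upper edges $\epsilon_1,\epsilon_2$ whose lower edge is an upper edge of a cointeraction with other upper edge $\epsilon_3$ is replaced by a cocontraction with upper edge $\epsilon_3$ and lower edges $\delta_1,\delta_2$ and two cointeractions with upper edges $\{\epsilon_1,\delta_1\}$ and $\{\epsilon_2,\delta_2\}$; $\mathsf{i}{\downarrow}$-$\mathsf{c}{\uparrow}$: an interaction with lower edges $\epsilon_3,\epsilon$, where $\epsilon$ is the upper edge of a cocontraction with lower edges $\epsilon_1,\epsilon_2$, is replaced by a contraction with lower edge $\epsilon_3$ and upper edges $\delta_1,\delta_2$ and two interactions with lower edges $\{\epsilon_1,\delta_1\}$ and $\{\epsilon_2,\delta_2\}$; $\mathsf{c}{\downarrow}$-$\mathsf{c}{\uparrow}$: a contraction with upper edges $\epsilon_1,\epsilon_2$ whose lower edge is the upper edge of a cocontraction with lower edges $\epsilon_3,\epsilon_4$ is replaced by two cocontractions with upper edges $\epsilon_1$, $\epsilon_2$ and two contractions with lower edges $\epsilon_3$, $\epsilon_4$, with one new edge from each cocontraction to each contraction. -}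

module Defs where

open import Data.Nat using (ℕ; _≡ᵇ_)
open import Data.Bool using (if_then_else_)
open import Data.Product using (_×_; _,_; proj₁; proj₂; Σ)
open import Data.List using (List; []; _∷_; _++_; map; concatMap)
open import Data.List.Membership.Propositional using (_∉_)
open import Data.List.Relation.Unary.Unique.Propositional using (Unique)
open import Data.List.Relation.Binary.Permutation.Propositional using (_↭_)
open import Data.List.Relation.Binary.Permutation.Homogeneous using (Permutation)
open import Relation.Binary.PropositionalEquality using (_≡_; _≢_)

data Atom : Set where
  pos neg : ℕ → Atom

bar : Atom → Atom
bar (pos n) = neg n
bar (neg n) = pos n

-- Formulae over a type X of atoms (X = Atom for SKS formulae,
-- X = LAtom for formulae whose atom occurrences carry edge names)

infixr 5 _∨_
infixr 6 _∧_

data Fm (X : Set) : Set where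
  𝕗 𝕥 : Fm X
  at  : X → Fm X
  _∨_ : Fm X → Fm X → Fm X
  _∧_ : Fm X → Fm X → Fm X

mapFm : {X Y : Set} → (X → Y) → Fm X → Fm Y
mapFm f 𝕗 = 𝕗
mapFm f 𝕥 = 𝕥
mapFm f (at x) = at (f x)
mapFm f (α ∨ β) = mapFm f α ∨ mapFm f β
mapFm f (α ∧ β) = mapFm f α ∧ mapFm f β

data Ctx (X : Set) : Set where
  □    : Ctx X
  _∨ₗ_ : Ctx X → Fm X → Ctx X
  _∨ᵣ_ : Fm X → Ctx X → Ctx X
  _∧ₗ_ : Ctx X → Fm X → Ctx X
  _∧ᵣ_ : Fm X → Ctx X → Ctx X

_[_] : {X : Set} → Ctx X → Fm X → Fm X
□ [ α ] = α
(ξ ∨ₗ β) [ α ] = (ξ [ α ]) ∨ β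
(β ∨ᵣ ξ) [ α ] = β ∨ (ξ [ α ])
(ξ ∧ₗ β) [ α ] = (ξ [ α ]) ∧ β
(β ∧ᵣ ξ) [ α ] = β ∧ (ξ [ α ])

-- the equations of "=" (each usable in both directions, see Lin)
data EqAx {X : Set} : Fm X → Fm X → Set where
  ∨-comm  : ∀ α β → EqAx (α ∨ β) (β ∨ α)
  ∧-comm  : ∀ α β → EqAx (α ∧ β) (β ∧ α)
  ∨-assoc : ∀ α β γ → EqAx ((α ∨ β) ∨ γ) (α ∨ (β ∨ γ))
  ∧-assoc : ∀ α β γ → EqAx ((α ∧ β) ∧ γ) (α ∧ (β ∧ γ))
  ∨-unit  : ∀ α → EqAx (α ∨ 𝕗) α
  ∧-unit  : ∀ α → EqAx (α ∧ 𝕥) α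
  𝕥∨𝕥     : EqAx (𝕥 ∨ 𝕥) 𝕥
  𝕗∧𝕗     : EqAx (𝕗 ∧ 𝕗) 𝕗

-- the non-atomic rules: switch, medial, =  (they do not touch atom occurrences)
data Lin {X : Set} : Fm X → Fm X → Set where
  switch : ∀ α β γ → Lin (α ∧ (β ∨ γ)) ((α ∧ β) ∨ γ)
  medial : ∀ α β γ δ → Lin ((α ∧ β) ∨ (γ ∧ δ)) ((α ∨ γ) ∧ (β ∨ δ))
  eq→    : ∀ {α β} → EqAx α β → Lin α β
  eq←    : ∀ {α β} → EqAx α β → Lin β α

-- Atomic flows, as concrete graphs whose edges are named by naturals.
-- A vertex lists its upper and lower edges.

data Vertex : Set where
  ai↓ : (l₁ l₂ : ℕ) → Vertex
  ai↑ : (u₁ u₂ : ℕ) → Vertex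
  aw↓ : (l : ℕ) → Vertex
  aw↑ : (u : ℕ) → Vertex
  ac↓ : (u₁ u₂ l : ℕ) → Vertex
  ac↑ : (u l₁ l₂ : ℕ) → Vertex

uppers : Vertex → List ℕ
uppers (ai↓ _ _) = []
uppers (ai↑ u₁ u₂) = u₁ ∷ u₂ ∷ []
uppers (aw↓ _) = []
uppers (aw↑ u) = u ∷ []
uppers (ac↓ u₁ u₂ _) = u₁ ∷ u₂ ∷ []
uppers (ac↑ u _ _) = u ∷ []

lowers : Vertex → List ℕ
lowers (ai↓ l₁ l₂) = l₁ ∷ l₂ ∷ []
lowers (ai↑ _ _) = []
lowers (aw↓ l) = l ∷ []
lowers (aw↑ _) = []
lowers (ac↓ _ _ l) = l ∷ []
lowers (ac↑ _ l₁ l₂) = l₁ ∷ l₂ ∷ []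

vedges : Vertex → List ℕ
vedges v = uppers v ++ lowers v

-- the two edges on the same side of a (co)interaction / (co)contraction
-- are unordered: identify vertices differing by such a swap
data _≅v_ : Vertex → Vertex → Set where
  same   : ∀ {v} → v ≅v v
  ai↓-sw : ∀ a b → ai↓ a b ≅v ai↓ b a
  ai↑-sw : ∀ a b → ai↑ a b ≅v ai↑ b a
  ac↓-sw : ∀ a b c → ac↓ a b c ≅v ac↓ b a c
  ac↑-sw : ∀ a b c → ac↑ a b c ≅v ac↑ a c b

-- a flow: its upper edges (upper end ⊤), lower edges (lower end ⊥), vertices
record Flow : Set where
  constructor ⟨_,_,_⟩
  field
    top   : List ℕ
    bot   : List ℕ
    verts : List Vertex
open Flow public

edges : Flow → List ℕ
edges C = top C ++ bot C ++ concatMap vedges (verts C)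

_≈F_ : Flow → Flow → Set
C ≈F D = (top C ↭ top D) × (bot C ↭ bot D) × Permutation _≅v_ (verts C) (verts D)

ren : ℕ → ℕ → ℕ → ℕ
ren a b n = if n ≡ᵇ a then b else n

renV : ℕ → ℕ → Vertex → Vertex
renV a b (ai↓ x y) = ai↓ (ren a b x) (ren a b y)
renV a b (ai↑ x y) = ai↑ (ren a b x) (ren a b y)
renV a b (aw↓ x) = aw↓ (ren a b x)
renV a b (aw↑ x) = aw↑ (ren a b x)
renV a b (ac↓ x y z) = ac↓ (ren a b x) (ren a b y) (ren a b z)
renV a b (ac↑ x y z) = ac↑ (ren a b x) (ren a b y) (ren a b z)

merge : ℕ → ℕ → List ℕ → List ℕ → List Vertex → Flow
merge a b T B V = ⟨ map (ren a b) T , map (ren a b) B , map (renV a b) V ⟩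

data RRule : Set where
  w↓-c↓ w↓-i↑ w↓-w↑ w↓-c↑ c↓-i↑ c↓-c↑ c↑-w↑ i↓-w↑ c↓-w↑ i↓-c↑ : RRule

-- C ⟶[ r ] D : the redex is listed first among the vertices of C
-- (C only matters up to ≈F in the theorem); new edges δ are fresh.
data _⟶[_]_ : Flow → RRule → Flow → Set where
  r-w↓-c↓ : ∀ T B V e x l →
    ⟨ T , B , aw↓ e ∷ ac↓ e x l ∷ V ⟩ ⟶[ w↓-c↓ ] merge l x T B V
  r-c↑-w↑ : ∀ T B V u e y →
    ⟨ T , B , ac↑ u e y ∷ aw↑ e ∷ V ⟩ ⟶[ c↑-w↑ ] merge y u T B V
  r-w↓-i↑ : ∀ T B V e y →
    ⟨ T , B , aw↓ e ∷ ai↑ e y ∷ V ⟩ ⟶[ w↓-i↑ ] ⟨ T , B , aw↑ y ∷ V ⟩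
  r-i↓-w↑ : ∀ T B V y e →
    ⟨ T , B , ai↓ y e ∷ aw↑ e ∷ V ⟩ ⟶[ i↓-w↑ ] ⟨ T , B , aw↓ y ∷ V ⟩
  r-w↓-w↑ : ∀ T B V e →
    ⟨ T , B , aw↓ e ∷ aw↑ e ∷ V ⟩ ⟶[ w↓-w↑ ] ⟨ T , B , V ⟩
  r-w↓-c↑ : ∀ T B V e l₁ l₂ →
    ⟨ T , B , aw↓ e ∷ ac↑ e l₁ l₂ ∷ V ⟩ ⟶[ w↓-c↑ ] ⟨ T , B , aw↓ l₁ ∷ aw↓ l₂ ∷ V ⟩
  r-c↓-w↑ : ∀ T B V u₁ u₂ e →
    ⟨ T , B , ac↓ u₁ u₂ e ∷ aw↑ e ∷ V ⟩ ⟶[ c↓-w↑ ] ⟨ T , B , aw↑ u₁ ∷ aw↑ u₂ ∷ V ⟩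
  r-c↓-i↑ : ∀ T B V ε₁ ε₂ ε₃ e δ₁ δ₂ →
    let C = ⟨ T , B , ac↓ ε₁ ε₂ e ∷ ai↑ e ε₃ ∷ V ⟩ in
    δ₁ ∉ edges C → δ₂ ∉ edges C → δ₁ ≢ δ₂ →
    C ⟶[ c↓-i↑ ] ⟨ T , B , ac↑ ε₃ δ₁ δ₂ ∷ ai↑ ε₁ δ₁ ∷ ai↑ ε₂ δ₂ ∷ V ⟩
  r-i↓-c↑ : ∀ T B V ε₁ ε₂ ε₃ e δ₁ δ₂ →
    let C = ⟨ T , B , ai↓ ε₃ e ∷ ac↑ e ε₁ ε₂ ∷ V ⟩ in
    δ₁ ∉ edges C → δ₂ ∉ edges C → δ₁ ≢ δ₂ →
    C ⟶[ i↓-c↑ ] ⟨ T , B , ac↓ δ₁ δ₂ ε₃ ∷ ai↓ ε₁ δ₁ ∷ ai↓ ε₂ δ₂ ∷ V ⟩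
  r-c↓-c↑ : ∀ T B V ε₁ ε₂ ε₃ ε₄ e δ₁ δ₂ δ₃ δ₄ →
    let C = ⟨ T , B , ac↓ ε₁ ε₂ e ∷ ac↑ e ε₃ ε₄ ∷ V ⟩ in
    Unique (δ₁ ∷ δ₂ ∷ δ₃ ∷ δ₄ ∷ []) →
    δ₁ ∉ edges C → δ₂ ∉ edges C → δ₃ ∉ edges C → δ₄ ∉ edges C →
    C ⟶[ c↓-c↑ ] ⟨ T , B , ac↑ ε₁ δ₁ δ₂ ∷ ac↑ ε₂ δ₃ δ₄ ∷ ac↓ δ₁ δ₃ ε₃ ∷ ac↓ δ₂ δ₄ ε₄ ∷ V ⟩

-- Every atom occurrence carries the name of the flow edge it belongs to;
-- switch, medial, = and contexts leave (atom, edge) pairs untouched, each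
-- atomic structural rule instance is a vertex.

LAtom : Set
LAtom = Atom × ℕ

LFm : Set
LFm = Fm LAtom

erase : LFm → Fm Atom
erase = mapFm proj₁

occs : LFm → List ℕ
occs 𝕗 = []
occs 𝕥 = []
occs (at (_ , e)) = e ∷ []
occs (α ∨ β) = occs α ++ occs β
occs (α ∧ β) = occs α ++ occs β

data ARule : LFm → LFm → Vertex → Set where
  ai↓ : ∀ a e₁ e₂ → ARule 𝕥 (at (a , e₁) ∨ at (bar a , e₂)) (ai↓ e₁ e₂)
  aw↓ : ∀ a e → ARule 𝕗 (at (a , e)) (aw↓ e)
  ac↓ : ∀ a e₁ e₂ e → ARule (at (a , e₁) ∨ at (a , e₂)) (at (a , e)) (ac↓ e₁ e₂ e)
  ai↑ : ∀ a e₁ e₂ → ARule (at (a , e₁) ∧ at (bar a , e₂)) 𝕗 (ai↑ e₁ e₂)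
  aw↑ : ∀ a e → ARule (at (a , e)) 𝕥 (aw↑ e)
  ac↑ : ∀ a e e₁ e₂ → ARule (at (a , e)) (at (a , e₁) ∧ at (a , e₂)) (ac↑ e e₁ e₂)

data Step : LFm → LFm → List Vertex → Set where
  lin    : ∀ {α β} (ξ : Ctx LAtom) → Lin α β → Step (ξ [ α ]) (ξ [ β ]) []
  atomic : ∀ {α β v} (ξ : Ctx LAtom) → ARule α β v → Step (ξ [ α ]) (ξ [ β ]) (v ∷ [])

data Der : LFm → LFm → List Vertex → Set where
  []  : ∀ {α} → Der α α []
  _∷_ : ∀ {α β γ vs ws} → Step α β vs → Der β γ ws → Der α γ (vs ++ ws)

flowOf : ∀ {P Q vs} → Der P Q vs → Flow
flowOf {P} {Q} {vs} _ = ⟨ occs P , occs Q , vs ⟩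

-- the edge names are a genuine tracing of atom occurrences: each edge has
-- exactly one upper end (⊤ or a vertex) and exactly one lower end (⊥ or a vertex)
Traced : ∀ {P Q vs} → Der P Q vs → Set
Traced {P} {Q} {vs} _ =
  Unique (occs P ++ concatMap lowers vs) ×
  (occs Q ++ concatMap uppers vs) ↭ (occs P ++ concatMap lowers vs)

module Submission where

-- In every rule the redex is a pair of vertices s₁, s₂ joined by an edge e
-- (a lower edge of s₁, an upper edge of s₂).  From a traced derivation Φ
-- with the left-hand flow we obtain Ψ by ONE substitution: an atom a on e
-- becomes a formula G a (𝕗 below a weakening, 𝕥 above a coweakening, a
-- disjunction or conjunction of copies of a at a (co)contraction), and every
-- other atom occurrence keeps its atom and has its edge renamed by f (the
-- identity, or the merge of two edges).  Switch, medial and = survive any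
-- substitution, atomic instances off e become renamed instances, and the two
-- redex instances become local derivations whose vertices are the right-hand
-- side.  Tracedness keeps e out of premiss and conclusion, so these are only
-- renamed.

open import Defs
open import Data.Empty using (⊥-elim)
open import Data.Product using (Σ; _×_; _,_; proj₁; proj₂)
open import Data.Sum using (_⊎_; inj₁; inj₂; [_,_]′)
open import Data.Nat using (ℕ; _≟_; _≡ᵇ_)
open import Data.Nat.Properties using (≡ᵇ⇒≡; ≡⇒≡ᵇ)
open import Data.Bool using (true; false)
import Data.Bool as Bool
open import Data.List using (List; []; _∷_; _++_; map; concatMap)
open import Data.List.Properties using (++-assoc; map-++; map-id; map-id-local; map-cong; concatMap-++)
open import Data.List.Membership.Propositional using (_∈_; _∉_)
open import Data.List.Membership.Propositional.Properties using (∈-++⁺ˡ; ∈-++⁺ʳ; ∈-++⁻; ∈-∃++)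
open import Data.List.Membership.DecPropositional _≟_ using (_∈?_)
open import Data.List.Relation.Unary.Any using (here; there)
open import Data.List.Relation.Unary.All as All using (All; []; _∷_)
import Data.List.Relation.Unary.All.Properties as AllP
open import Data.List.Relation.Unary.AllPairs using ([]; _∷_)
open import Data.List.Relation.Unary.Unique.Propositional using (Unique)
import Data.List.Relation.Unary.Unique.Propositional.Properties as Unique
open import Data.List.Relation.Binary.Subset.Propositional using (_⊆_)
open import Data.List.Relation.Binary.Pointwise.Base using (Pointwise)
open import Data.List.Relation.Binary.Permutation.Homogeneous as Perm using (Permutation)
open import Data.List.Relation.Binary.Permutation.Propositional
  using (_↭_; ↭-refl; ↭-sym; ↭-trans; ↭-prep; ↭-swap; ↭-reflexive; ↭⇒↭ₛ; ↭ₛ⇒↭)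
import Data.List.Relation.Binary.Permutation.Propositional.Properties as ↭
import Data.List.Relation.Binary.Permutation.Setoid.Properties as ↭ₛ
open import Relation.Binary.Bundles using (Setoid)
open import Relation.Binary.PropositionalEquality
  using (_≡_; _≢_; refl; sym; trans; cong; cong₂; subst; subst₂; ≢-sym)
import Relation.Binary.PropositionalEquality.Properties as ≡
open import Relation.Nullary using (yes; no)

substFm : {X Y : Set} → (X → Fm Y) → Fm X → Fm Y
substFm σ 𝕗 = 𝕗
substFm σ 𝕥 = 𝕥
substFm σ (at x) = σ x
substFm σ (α ∨ β) = substFm σ α ∨ substFm σ β
substFm σ (α ∧ β) = substFm σ α ∧ substFm σ β

substCtx : {X Y : Set} → (X → Fm Y) → Ctx X → Ctx Y
substCtx σ □ = □
substCtx σ (ξ ∨ₗ β) = substCtx σ ξ ∨ₗ substFm σ β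
substCtx σ (β ∨ᵣ ξ) = substFm σ β ∨ᵣ substCtx σ ξ
substCtx σ (ξ ∧ₗ β) = substCtx σ ξ ∧ₗ substFm σ β
substCtx σ (β ∧ᵣ ξ) = substFm σ β ∧ᵣ substCtx σ ξ

substFm-plug : {X Y : Set} (σ : X → Fm Y) (ξ : Ctx X) (α : Fm X) →
  substFm σ (ξ [ α ]) ≡ substCtx σ ξ [ substFm σ α ]
substFm-plug σ □ α = refl
substFm-plug σ (ξ ∨ₗ β) α = cong (_∨ substFm σ β) (substFm-plug σ ξ α)
substFm-plug σ (β ∨ᵣ ξ) α = cong (substFm σ β ∨_) (substFm-plug σ ξ α)
substFm-plug σ (ξ ∧ₗ β) α = cong (_∧ substFm σ β) (substFm-plug σ ξ α)
substFm-plug σ (β ∧ᵣ ξ) α = cong (substFm σ β ∧_) (substFm-plug σ ξ α)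

-- the equations of = and the rules switch and medial are schematic in
-- their formulae, hence closed under substitution
substEqAx : {X Y : Set} (σ : X → Fm Y) {α β : Fm X} → EqAx α β → EqAx (substFm σ α) (substFm σ β)
substEqAx σ (∨-comm α β) = ∨-comm _ _
substEqAx σ (∧-comm α β) = ∧-comm _ _
substEqAx σ (∨-assoc α β γ) = ∨-assoc _ _ _
substEqAx σ (∧-assoc α β γ) = ∧-assoc _ _ _
substEqAx σ (∨-unit α) = ∨-unit _
substEqAx σ (∧-unit α) = ∧-unit _
substEqAx σ 𝕥∨𝕥 = 𝕥∨𝕥
substEqAx σ 𝕗∧𝕗 = 𝕗∧𝕗

substLin : {X Y : Set} (σ : X → Fm Y) {α β : Fm X} → Lin α β → Lin (substFm σ α) (substFm σ β)
substLin σ (switch α β γ) = switch _ _ _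
substLin σ (medial α β γ δ) = medial _ _ _ _
substLin σ (eq→ ax) = eq→ (substEqAx σ ax)
substLin σ (eq← ax) = eq← (substEqAx σ ax)

infixr 4 _⨾_

_⨾_ : ∀ {α β γ vs ws} → Der α β vs → Der β γ ws → Der α γ (vs ++ ws)
[] ⨾ Ψ = Ψ
_⨾_ {ws = ws} (_∷_ {vs = us} {ws = vs} s Φ) Ψ =
  subst (Der _ _) (sym (++-assoc us vs ws)) (s ∷ (Φ ⨾ Ψ))

_∘ᶜ_ : {X : Set} → Ctx X → Ctx X → Ctx X
□ ∘ᶜ ζ = ζ
(ξ ∨ₗ β) ∘ᶜ ζ = (ξ ∘ᶜ ζ) ∨ₗ β
(β ∨ᵣ ξ) ∘ᶜ ζ = β ∨ᵣ (ξ ∘ᶜ ζ)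
(ξ ∧ₗ β) ∘ᶜ ζ = (ξ ∘ᶜ ζ) ∧ₗ β
(β ∧ᵣ ξ) ∘ᶜ ζ = β ∧ᵣ (ξ ∘ᶜ ζ)

plug-∘ᶜ : {X : Set} (ξ ζ : Ctx X) (α : Fm X) → (ξ ∘ᶜ ζ) [ α ] ≡ ξ [ ζ [ α ] ]
plug-∘ᶜ □ ζ α = refl
plug-∘ᶜ (ξ ∨ₗ β) ζ α = cong (_∨ β) (plug-∘ᶜ ξ ζ α)
plug-∘ᶜ (β ∨ᵣ ξ) ζ α = cong (β ∨_) (plug-∘ᶜ ξ ζ α)
plug-∘ᶜ (ξ ∧ₗ β) ζ α = cong (_∧ β) (plug-∘ᶜ ξ ζ α)
plug-∘ᶜ (β ∧ᵣ ξ) ζ α = cong (β ∧_) (plug-∘ᶜ ξ ζ α)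

stepInCtx : ∀ {α β vs} (ξ : Ctx LAtom) → Step α β vs → Step (ξ [ α ]) (ξ [ β ]) vs
stepInCtx ξ (lin {α} {β} ζ l) =
  subst₂ (λ A B → Step A B []) (plug-∘ᶜ ξ ζ α) (plug-∘ᶜ ξ ζ β) (lin (ξ ∘ᶜ ζ) l)
stepInCtx ξ (atomic {α} {β} {v} ζ r) =
  subst₂ (λ A B → Step A B (v ∷ [])) (plug-∘ᶜ ξ ζ α) (plug-∘ᶜ ξ ζ β) (atomic (ξ ∘ᶜ ζ) r)

derInCtx : ∀ {α β vs} (ξ : Ctx LAtom) → Der α β vs → Der (ξ [ α ]) (ξ [ β ]) vs
derInCtx ξ [] = []
derInCtx ξ (s ∷ Φ) = stepInCtx ξ s ∷ derInCtx ξ Φ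

linDer : ∀ {α β} (ξ : Ctx LAtom) → Lin α β → Der (ξ [ α ]) (ξ [ β ]) []
linDer ξ l = lin ξ l ∷ []

ruleDer : ∀ {α β v} (ξ : Ctx LAtom) → ARule α β v → Der (ξ [ α ]) (ξ [ β ]) (v ∷ [])
ruleDer ξ r = atomic ξ r ∷ []

castDer : ∀ {α α′ β β′ vs} → α ≡ α′ → β ≡ β′ → Der α′ β′ vs → Der α β vs
castDer refl refl Φ = Φ

-- 𝕗 ⇒ 𝕥 needs no atomic rule: 𝕗 = (𝕗 ∧ [𝕗 ∨ 𝕥]) → [(𝕗 ∧ 𝕗) ∨ 𝕥] = 𝕥
𝕗⇒𝕥 : Der 𝕗 𝕥 []
𝕗⇒𝕥 = linDer □ (eq← (∧-unit 𝕗)) ⨾ linDer (𝕗 ∧ᵣ □) (eq← (∨-unit 𝕥))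
  ⨾ linDer (𝕗 ∧ᵣ □) (eq→ (∨-comm 𝕥 𝕗)) ⨾ linDer □ (switch 𝕗 𝕗 𝕥) ⨾ linDer (□ ∨ₗ 𝕥) (eq→ 𝕗∧𝕗)
  ⨾ linDer □ (eq→ (∨-comm 𝕗 𝕥)) ⨾ linDer □ (eq→ (∨-unit 𝕥))

-- Substitution acting on a whole derivation: the non-atomic steps are
-- carried along, and each atomic instance (with a vertex satisfying Good)
-- is replaced by a local derivation contributing the vertices out v.
module SubstDer (σ : LAtom → LFm) (out : Vertex → List Vertex) (Good : Vertex → Set)
  (local : ∀ {α β v} → ARule α β v → Good v → Der (substFm σ α) (substFm σ β) (out v)) where

  substDer : ∀ {P Q vs} → Der P Q vs → All Good vs →
    Der (substFm σ P) (substFm σ Q) (concatMap out vs)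
  substDer [] _ = []
  substDer (lin {α} {β} ξ l ∷ Φ) goods =
    castDer (substFm-plug σ ξ α) (substFm-plug σ ξ β) (linDer (substCtx σ ξ) (substLin σ l))
    ⨾ substDer Φ goods
  substDer (atomic {α} {β} ξ r ∷ Φ) (good ∷ goods) =
    castDer (substFm-plug σ ξ α) (substFm-plug σ ξ β) (derInCtx (substCtx σ ξ) (local r good))
    ⨾ substDer Φ goods

renameV : (ℕ → ℕ) → Vertex → Vertex
renameV f (ai↓ x y) = ai↓ (f x) (f y)
renameV f (ai↑ x y) = ai↑ (f x) (f y)
renameV f (aw↓ x) = aw↓ (f x)
renameV f (aw↑ x) = aw↑ (f x)
renameV f (ac↓ x y z) = ac↓ (f x) (f y) (f z)
renameV f (ac↑ x y z) = ac↑ (f x) (f y) (f z)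

renameFm : (ℕ → ℕ) → LFm → LFm
renameFm f = mapFm (λ (a , n) → a , f n)

renameRule : ∀ f {α β v} → ARule α β v → ARule (renameFm f α) (renameFm f β) (renameV f v)
renameRule f (ai↓ a e₁ e₂) = ai↓ a (f e₁) (f e₂)
renameRule f (aw↓ a e) = aw↓ a (f e)
renameRule f (ac↓ a e₁ e₂ e) = ac↓ a (f e₁) (f e₂) (f e)
renameRule f (ai↑ a e₁ e₂) = ai↑ a (f e₁) (f e₂)
renameRule f (aw↑ a e) = aw↑ a (f e)
renameRule f (ac↑ a e e₁ e₂) = ac↑ a (f e) (f e₁) (f e₂)

occs-upper : ∀ {α β v} → ARule α β v → occs α ≡ uppers v
occs-upper (ai↓ a e₁ e₂) = refl
occs-upper (aw↓ a e) = refl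
occs-upper (ac↓ a e₁ e₂ e) = refl
occs-upper (ai↑ a e₁ e₂) = refl
occs-upper (aw↑ a e) = refl
occs-upper (ac↑ a e e₁ e₂) = refl

occs-lower : ∀ {α β v} → ARule α β v → occs β ≡ lowers v
occs-lower (ai↓ a e₁ e₂) = refl
occs-lower (aw↓ a e) = refl
occs-lower (ac↓ a e₁ e₂ e) = refl
occs-lower (ai↑ a e₁ e₂) = refl
occs-lower (aw↑ a e) = refl
occs-lower (ac↑ a e e₁ e₂) = refl

erase-renameFm : ∀ f α → erase (renameFm f α) ≡ erase α
erase-renameFm f 𝕗 = refl
erase-renameFm f 𝕥 = refl
erase-renameFm f (at x) = refl
erase-renameFm f (α ∨ β) = cong₂ _∨_ (erase-renameFm f α) (erase-renameFm f β)
erase-renameFm f (α ∧ β) = cong₂ _∧_ (erase-renameFm f α) (erase-renameFm f β)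

occs-renameFm : ∀ f α → occs (renameFm f α) ≡ map f (occs α)
occs-renameFm f 𝕗 = refl
occs-renameFm f 𝕥 = refl
occs-renameFm f (at x) = refl
occs-renameFm f (α ∨ β) =
  trans (cong₂ _++_ (occs-renameFm f α) (occs-renameFm f β)) (sym (map-++ f (occs α) (occs β)))
occs-renameFm f (α ∧ β) =
  trans (cong₂ _++_ (occs-renameFm f α) (occs-renameFm f β)) (sym (map-++ f (occs α) (occs β)))

uppers-renameV : ∀ f v → uppers (renameV f v) ≡ map f (uppers v)
uppers-renameV f (ai↓ _ _) = refl
uppers-renameV f (ai↑ _ _) = refl
uppers-renameV f (aw↓ _) = refl
uppers-renameV f (aw↑ _) = refl
uppers-renameV f (ac↓ _ _ _) = refl
uppers-renameV f (ac↑ _ _ _) = refl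

lowers-renameV : ∀ f v → lowers (renameV f v) ≡ map f (lowers v)
lowers-renameV f (ai↓ _ _) = refl
lowers-renameV f (ai↑ _ _) = refl
lowers-renameV f (aw↓ _) = refl
lowers-renameV f (aw↑ _) = refl
lowers-renameV f (ac↓ _ _ _) = refl
lowers-renameV f (ac↑ _ _ _) = refl

renameV-ren : ∀ a b v → renameV (ren a b) v ≡ renV a b v
renameV-ren a b (ai↓ _ _) = refl
renameV-ren a b (ai↑ _ _) = refl
renameV-ren a b (aw↓ _) = refl
renameV-ren a b (aw↑ _) = refl
renameV-ren a b (ac↓ _ _ _) = refl
renameV-ren a b (ac↑ _ _ _) = refl

renameV-id : ∀ v → renameV (λ n → n) v ≡ v
renameV-id (ai↓ _ _) = refl
renameV-id (ai↑ _ _) = refl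
renameV-id (aw↓ _) = refl
renameV-id (aw↑ _) = refl
renameV-id (ac↓ _ _ _) = refl
renameV-id (ac↑ _ _ _) = refl

≅v-sym : ∀ {v w} → v ≅v w → w ≅v v
≅v-sym same = same
≅v-sym (ai↓-sw a b) = ai↓-sw b a
≅v-sym (ai↑-sw a b) = ai↑-sw b a
≅v-sym (ac↓-sw a b c) = ac↓-sw b a c
≅v-sym (ac↑-sw a b c) = ac↑-sw a c b

≅v-trans : ∀ {u v w} → u ≅v v → v ≅v w → u ≅v w
≅v-trans same q = q
≅v-trans p same = p
≅v-trans (ai↓-sw a b) (ai↓-sw .b .a) = same
≅v-trans (ai↑-sw a b) (ai↑-sw .b .a) = same
≅v-trans (ac↓-sw a b c) (ac↓-sw .b .a .c) = same
≅v-trans (ac↑-sw a b c) (ac↑-sw .a .c .b) = same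

vertexSetoid : Setoid _ _
vertexSetoid = record
  { Carrier = Vertex ; _≈_ = _≅v_
  ; isEquivalence = record { refl = same ; sym = ≅v-sym ; trans = ≅v-trans } }

infix 4 _≈V_
_≈V_ : List Vertex → List Vertex → Set
_≈V_ = Permutation _≅v_

≈V-reflexive : ∀ {vs ws} → vs ≡ ws → vs ≈V ws
≈V-reflexive {vs} refl = Perm.refl (pointwise-refl vs)
  where
  pointwise-refl : ∀ xs → Pointwise _≅v_ xs xs
  pointwise-refl [] = Pointwise.[]
  pointwise-refl (x ∷ xs) = same Pointwise.∷ pointwise-refl xs

≈V-sym : ∀ {vs ws} → vs ≈V ws → ws ≈V vs
≈V-sym = Perm.sym ≅v-sym

concatMap⁺ : ∀ {A : Set} {R : A → A → Set} {c ℓ} (S : Setoid c ℓ) (h : A → List (Setoid.Carrier S)) →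
  (∀ {x y} → R x y → Permutation (Setoid._≈_ S) (h x) (h y)) →
  ∀ {xs ys} → Permutation R xs ys → Permutation (Setoid._≈_ S) (concatMap h xs) (concatMap h ys)
concatMap⁺ {R = R} S h resp (Perm.refl pw) = pointwise pw
  where
  pointwise : ∀ {xs ys} → Pointwise R xs ys → Permutation (Setoid._≈_ S) (concatMap h xs) (concatMap h ys)
  pointwise Pointwise.[] = Perm.refl Pointwise.[]
  pointwise (r Pointwise.∷ pw) = ↭ₛ.++⁺ S (resp r) (pointwise pw)
concatMap⁺ S h resp (Perm.prep r p) = ↭ₛ.++⁺ S (resp r) (concatMap⁺ S h resp p)
concatMap⁺ S h resp (Perm.swap {x′ = x′} {y′ = y′} r₁ r₂ p) =
  Perm.trans (↭ₛ.++⁺ S (resp r₁) (↭ₛ.++⁺ S (resp r₂) (concatMap⁺ S h resp p))) (↭ₛ.shifts S (h x′) (h y′))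
concatMap⁺ S h resp (Perm.trans p q) = Perm.trans (concatMap⁺ S h resp p) (concatMap⁺ S h resp q)

edgeList-↭ : (h : Vertex → List ℕ) → (∀ {v w} → v ≅v w → h v ↭ h w) →
  ∀ {vs ws} → vs ≈V ws → concatMap h vs ↭ concatMap h ws
edgeList-↭ h resp p = ↭ₛ⇒↭ (concatMap⁺ (≡.setoid ℕ) h (λ r → ↭⇒↭ₛ (resp r)) p)

uppers-≅ : ∀ {v w} → v ≅v w → uppers v ↭ uppers w
uppers-≅ same = ↭-refl
uppers-≅ (ai↓-sw a b) = ↭-refl
uppers-≅ (ai↑-sw a b) = ↭-swap a b ↭-refl
uppers-≅ (ac↓-sw a b c) = ↭-swap a b ↭-refl
uppers-≅ (ac↑-sw a b c) = ↭-refl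

lowers-≅ : ∀ {v w} → v ≅v w → lowers v ↭ lowers w
lowers-≅ same = ↭-refl
lowers-≅ (ai↓-sw a b) = ↭-swap a b ↭-refl
lowers-≅ (ai↑-sw a b) = ↭-refl
lowers-≅ (ac↓-sw a b c) = ↭-refl
lowers-≅ (ac↑-sw a b c) = ↭-swap b c ↭-refl

vedges-≅ : ∀ {v w} → v ≅v w → vedges v ↭ vedges w
vedges-≅ p = ↭.++⁺ (uppers-≅ p) (lowers-≅ p)

renameV-≅ : ∀ f {v w} → v ≅v w → renameV f v ≅v renameV f w
renameV-≅ f same = same
renameV-≅ f (ai↓-sw a b) = ai↓-sw _ _
renameV-≅ f (ai↑-sw a b) = ai↑-sw _ _
renameV-≅ f (ac↓-sw a b c) = ac↓-sw _ _ _
renameV-≅ f (ac↑-sw a b c) = ac↑-sw _ _ _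

data Kind : Set where
  interaction cointeraction weakening coweakening contraction cocontraction : Kind

kind : Vertex → Kind
kind (ai↓ _ _) = interaction
kind (ai↑ _ _) = cointeraction
kind (aw↓ _) = weakening
kind (aw↑ _) = coweakening
kind (ac↓ _ _ _) = contraction
kind (ac↑ _ _ _) = cocontraction

kind-≅ : ∀ {v w} → v ≅v w → kind v ≡ kind w
kind-≅ same = refl
kind-≅ (ai↓-sw a b) = refl
kind-≅ (ai↑-sw a b) = refl
kind-≅ (ac↓-sw a b c) = refl
kind-≅ (ac↑-sw a b c) = refl

lowerEdges upperEdges : List Vertex → List ℕ
lowerEdges = concatMap lowers
upperEdges = concatMap uppers

edgeList-rename : (h : Vertex → List ℕ) → (∀ f v → h (renameV f v) ≡ map f (h v)) →
  ∀ f vs → concatMap h (map (renameV f) vs) ≡ map f (concatMap h vs)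
edgeList-rename h h-rename f [] = refl
edgeList-rename h h-rename f (v ∷ vs) =
  trans (cong₂ _++_ (h-rename f v) (edgeList-rename h h-rename f vs)) (sym (map-++ f (h v) (concatMap h vs)))

-- A traced derivation with premiss P, conclusion Q and
-- vertices vs is exactly one for which the lower ends L = occs P ++
-- lowerEdges vs are duplicate-free and the upper ends U = occs Q ++
-- upperEdges vs are a permutation of them: every edge has one upper and one
-- lower end.
Balanced : List ℕ → List ℕ → Set
Balanced L U = Unique L × U ↭ L

unique-↭ : ∀ {xs ys : List ℕ} → xs ↭ ys → Unique xs → Unique ys
unique-↭ p = ↭ₛ.Unique-resp-↭ (≡.setoid ℕ) (↭⇒↭ₛ p)

balanced-↭ : ∀ {L L′ U U′} → L ↭ L′ → U ↭ U′ → Balanced L U → Balanced L′ U′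
balanced-↭ L↭L′ U↭U′ (L-unique , U↭L) =
  unique-↭ L↭L′ L-unique , ↭-trans (↭-sym U↭U′) (↭-trans U↭L L↭L′)

balanced-tail : ∀ {e L U} → Balanced (e ∷ L) (e ∷ U) → Balanced L U
balanced-tail ((_ ∷ L-unique) , U↭L) = L-unique , ↭.drop-∷ U↭L

balanced-fresh : ∀ {ds L U E} → Unique ds → All (_∉ E) ds → L ⊆ E → Balanced L U → Balanced (ds ++ L) (ds ++ U)
balanced-fresh ds-unique ds-fresh L⊆E (L-unique , U↭L) =
  Unique.++⁺ ds-unique L-unique (λ (d∈ds , d∈L) → All.lookup ds-fresh d∈ds (L⊆E d∈L)) , ↭.++⁺ˡ _ U↭L

unique-prefix : ∀ (xs : List ℕ) {ys} → Unique (xs ++ ys) → Unique xs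
unique-prefix [] _ = []
unique-prefix (x ∷ xs) (x∉ ∷ u) = AllP.++⁻ˡ xs x∉ ∷ unique-prefix xs u

unique-disjoint : ∀ {n : ℕ} xs {ys} → Unique (xs ++ ys) → n ∈ xs → n ∉ ys
unique-disjoint (x ∷ xs) (x∉ ∷ _) (here refl) n∈ys = All.lookup x∉ (∈-++⁺ʳ xs n∈ys) refl
unique-disjoint (x ∷ xs) (_ ∷ u) (there n∈xs) n∈ys = unique-disjoint xs u n∈xs n∈ys

lowers⊆vedges : ∀ vs → lowerEdges vs ⊆ concatMap vedges vs
lowers⊆vedges (v ∷ vs) n∈ with ∈-++⁻ (lowers v) n∈
... | inj₁ n∈v = ∈-++⁺ˡ (∈-++⁺ʳ (uppers v) n∈v)
... | inj₂ n∈vs = ∈-++⁺ʳ (vedges v) (lowers⊆vedges vs n∈vs)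

lowerEnds⊆edges : ∀ {P Q vs C} (Φ : Der P Q vs) → flowOf Φ ≈F C → occs P ++ lowerEdges vs ⊆ edges C
lowerEnds⊆edges {P} {vs = vs} {C} Φ (P↭T , _ , vs≈V) n∈ with ∈-++⁻ (occs P) n∈
... | inj₁ n∈P = ∈-++⁺ˡ (↭.∈-resp-↭ P↭T n∈P)
... | inj₂ n∈vs = ∈-++⁺ʳ (top C) (∈-++⁺ʳ (bot C)
      (↭.∈-resp-↭ (edgeList-↭ vedges vedges-≅ vs≈V) (lowers⊆vedges vs n∈vs)))

redexEnds : (h : Vertex → List ℕ) → (∀ {v w} → v ≅v w → h v ↭ h w) →
  ∀ s₁ s₂ V R {vs} → vs ≈V s₁ ∷ s₂ ∷ V →
  R ++ concatMap h vs ↭ (h s₁ ++ h s₂) ++ (concatMap h V ++ R)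
redexEnds h h-≅ s₁ s₂ V R vs≈ = ↭-trans (↭.++⁺ˡ R (edgeList-↭ h h-≅ vs≈)) (↭-trans
  (↭.++-comm R (h s₁ ++ (h s₂ ++ concatMap h V)))
  (↭-reflexive (trans (++-assoc (h s₁) _ R) (trans (cong (h s₁ ++_) (++-assoc (h s₂) _ R))
    (sym (++-assoc (h s₁) (h s₂) _))))))

redexBalanced : ∀ {T B V} s₁ s₂ {P Q vs} (Φ : Der P Q vs) → Traced Φ →
  flowOf Φ ≈F ⟨ T , B , s₁ ∷ s₂ ∷ V ⟩ →
  Balanced ((lowers s₁ ++ lowers s₂) ++ (lowerEdges V ++ occs P))
           ((uppers s₁ ++ uppers s₂) ++ (upperEdges V ++ occs Q))
redexBalanced {V = V} s₁ s₂ {P} {Q} Φ traced (_ , _ , vs≈) = balanced-↭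
  (redexEnds lowers lowers-≅ s₁ s₂ V (occs P) vs≈) (redexEnds uppers uppers-≅ s₁ s₂ V (occs Q) vs≈) traced

redexDistinct : ∀ {T B V} s₁ s₂ {P Q vs} (Φ : Der P Q vs) → Traced Φ →
  flowOf Φ ≈F ⟨ T , B , s₁ ∷ s₂ ∷ V ⟩ →
  Unique (lowers s₁ ++ lowers s₂) × Unique (uppers s₁ ++ uppers s₂)
redexDistinct s₁ s₂ Φ traced ≈C with redexBalanced s₁ s₂ Φ traced ≈C
... | L-unique , U↭L = unique-prefix (lowers s₁ ++ lowers s₂) L-unique ,
                      unique-prefix (uppers s₁ ++ uppers s₂) (unique-↭ (↭-sym U↭L) L-unique)

-- What a contraction must establish about the edge lists: the redex has
-- lower ends Ls and upper ends Us, its replacement Ls′ and Us′, the other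
-- edges (X, Y) are renamed by f, and E contains all edges of the old flow.
Bookkeeping : (E : List ℕ) (f : ℕ → ℕ) (Ls Us Ls′ Us′ : List ℕ) → Set
Bookkeeping E f Ls Us Ls′ Us′ = ∀ X Y → Ls ++ X ⊆ E → Balanced (Ls ++ X) (Us ++ Y) →
  Balanced (Ls′ ++ map f X) (Us′ ++ map f Y)

-- No renaming: the joining edge e disappears, the remaining redex ends K, J
-- stay, and the replacement adds pairwise distinct fresh edges ds.
bookkeeping-fresh : ∀ {E e Ls Us Ls′ Us′} K J ds →
  Ls ↭ e ∷ K → Us ↭ e ∷ J → Ls′ ↭ ds ++ K → Us′ ↭ ds ++ J →
  Unique ds → All (_∉ E) ds → Bookkeeping E (λ n → n) Ls Us Ls′ Us′
bookkeeping-fresh {E} K J ds Ls↭ Us↭ Ls′↭ Us′↭ ds-unique ds-fresh X Y LsX⊆E bal =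
  balanced-↭ (reorder Ls′↭ X) (reorder Us′↭ Y)
    (balanced-fresh ds-unique ds-fresh KX⊆E
      (balanced-tail (balanced-↭ (↭.++⁺ʳ X Ls↭) (↭.++⁺ʳ Y Us↭) bal)))
  where
  KX⊆E : K ++ X ⊆ E
  KX⊆E n∈ = LsX⊆E (↭.∈-resp-↭ (↭-sym (↭.++⁺ʳ X Ls↭)) (there n∈))
  reorder : ∀ {Z′ K} → Z′ ↭ ds ++ K → ∀ Z → ds ++ K ++ Z ↭ Z′ ++ map (λ n → n) Z
  reorder {K = K} Z′↭ Z = ↭-sym (↭-trans (↭.++⁺ Z′↭ (↭-reflexive (map-id Z))) (↭-reflexive (++-assoc ds K Z)))

ren-hit : ∀ a b → ren a b a ≡ b
ren-hit a b with a ≡ᵇ a | ≡⇒≡ᵇ a a refl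
... | true | _ = refl

ren-miss : ∀ {a b n} → n ≢ a → ren a b n ≡ n
ren-miss {a} {b} {n} n≢a with n ≡ᵇ a in eq
... | true = ⊥-elim (n≢a (≡ᵇ⇒≡ n a (subst Bool.T (sym eq) _)))
... | false = refl

ren-target : ∀ a b → ren a b b ≡ b
ren-target a b with b ≡ᵇ a
... | true = refl
... | false = refl

-- if x ∷ Y is a permutation of l ∷ X, then merging l into x makes Y a
-- permutation of X (x is either l itself or an element of X)
merged-↭ : ∀ l x {X Y} → x ∷ Y ↭ l ∷ X → map (ren l x) Y ↭ map (ren l x) X
merged-↭ l x p with x ≟ l
... | yes refl = ↭.map⁺ _ (↭.drop-∷ p)
... | no x≢l with ↭.∈-resp-↭ p (here refl)
...   | here x≡l = ⊥-elim (x≢l x≡l)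
...   | there x∈X with ∈-∃++ x∈X
...     | A , C , refl = ↭-trans (↭.map⁺ f Y↭l∷AC)
          (↭-trans (↭-reflexive (cong (_∷ map f (A ++ C)) l-and-x↦x)) (↭.map⁺ f (↭-sym (↭.shift x A C))))
  where
  f = ren l x
  l-and-x↦x : f l ≡ f x
  l-and-x↦x = trans (ren-hit l x) (sym (ren-miss x≢l))
  Y↭l∷AC : _ ↭ l ∷ A ++ C
  Y↭l∷AC = ↭.drop-∷ (↭-trans p (↭-trans (↭-prep l (↭.shift x A C)) (↭-swap l x ↭-refl)))

-- Merging: the joining edge e disappears, and the remaining lower end l
-- and upper end x of the redex are glued into the single edge x.
bookkeeping-merge : ∀ {E e Ls Us} l x → Ls ↭ e ∷ l ∷ [] → Us ↭ e ∷ x ∷ [] →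
  Bookkeeping E (ren l x) Ls Us [] []
bookkeeping-merge l x Ls↭ Us↭ X Y _ bal
  with balanced-tail (balanced-↭ (↭.++⁺ʳ X Ls↭) (↭.++⁺ʳ Y Us↭) bal)
... | (l∉X ∷ X-unique) , x∷Y↭l∷X =
  subst Unique (sym X-fixed) X-unique , merged-↭ l x x∷Y↭l∷X
  where
  X-fixed : map (ren l x) X ≡ X
  X-fixed = map-id-local (All.map (λ l≢n → ren-miss (λ n≡l → l≢n (sym n≡l))) l∉X)

∉-++⁻ : ∀ {n : ℕ} xs {ys} → n ∉ xs ++ ys → n ∉ xs × n ∉ ys
∉-++⁻ xs n∉ = (λ n∈xs → n∉ (∈-++⁺ˡ n∈xs)) , (λ n∈ys → n∉ (∈-++⁺ʳ xs n∈ys))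

avoiding : ∀ {e} V → e ∉ upperEdges V → e ∉ lowerEdges V → All (λ v → e ∉ vedges v) V
avoiding [] _ _ = []
avoiding (v ∷ V) e∉U e∉L with ∉-++⁻ (uppers v) e∉U | ∉-++⁻ (lowers v) e∉L
... | e∉Uv , e∉UV | e∉Lv , e∉LV =
  (λ e∈v → [ e∉Uv , e∉Lv ]′ (∈-++⁻ (uppers v) e∈v)) ∷ avoiding V e∉UV e∉LV

Realisable : LFm → LFm → Flow → Set
Realisable P Q D = Σ LFm λ P′ → Σ LFm λ Q′ → Σ (List Vertex) λ ws → Σ (Der P′ Q′ ws) λ Ψ →
  erase P′ ≡ erase P × erase Q′ ≡ erase Q × Traced Ψ × flowOf Ψ ≈F D

Sound : Flow → Flow → Set
Sound C D = ∀ {P Q : LFm} {vs : List Vertex} (Φ : Der P Q vs) → Traced Φ → flowOf Φ ≈F C →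
  Realisable P Q D

module Contract (e : ℕ) (f : ℕ → ℕ) (G : Atom → LFm) where

  σ : LAtom → LFm
  σ (a , n) with n ≟ e
  ... | yes _ = G a
  ... | no _ = at (a , f n)

  σ-on-e : ∀ a → σ (a , e) ≡ G a
  σ-on-e a with e ≟ e
  ... | yes _ = refl
  ... | no e≢e = ⊥-elim (e≢e refl)

  σ-off-e : ∀ a {n} → n ≢ e → σ (a , n) ≡ at (a , f n)
  σ-off-e a {n} n≢e with n ≟ e
  ... | yes n≡e = ⊥-elim (n≢e n≡e)
  ... | no _ = refl

  substFm-off-e : ∀ α → e ∉ occs α → substFm σ α ≡ renameFm f α
  substFm-off-e 𝕗 _ = refl
  substFm-off-e 𝕥 _ = refl
  substFm-off-e (at (a , n)) e∉ = σ-off-e a (λ n≡e → e∉ (here (sym n≡e)))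
  substFm-off-e (α ∨ β) e∉ with ∉-++⁻ (occs α) e∉
  ... | e∉α , e∉β = cong₂ _∨_ (substFm-off-e α e∉α) (substFm-off-e β e∉β)
  substFm-off-e (α ∧ β) e∉ with ∉-++⁻ (occs α) e∉
  ... | e∉α , e∉β = cong₂ _∧_ (substFm-off-e α e∉α) (substFm-off-e β e∉β)

  -- new k lists the vertices replacing a redex vertex of kind k
  module Replace (new : Kind → List Vertex) where

    out : Vertex → List Vertex
    out v with e ∈? vedges v
    ... | yes _ = new (kind v)
    ... | no _ = renameV f v ∷ []

    out-on-e : ∀ v → e ∈ vedges v → out v ≡ new (kind v)
    out-on-e v e∈v with e ∈? vedges v
    ... | yes _ = refl
    ... | no e∉v = ⊥-elim (e∉v e∈v)

    out-off-e : ∀ v → e ∉ vedges v → out v ≡ renameV f v ∷ []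
    out-off-e v e∉v with e ∈? vedges v
    ... | yes e∈v = ⊥-elim (e∉v e∈v)
    ... | no _ = refl

    out-≅ : ∀ {v w} → v ≅v w → out v ≈V out w
    out-≅ {v} {w} v≅w with e ∈? vedges v | e ∈? vedges w
    ... | yes _ | yes _ = ≈V-reflexive (cong new (kind-≅ v≅w))
    ... | yes e∈v | no e∉w = ⊥-elim (e∉w (↭.∈-resp-↭ (vedges-≅ v≅w) e∈v))
    ... | no e∉v | yes e∈w = ⊥-elim (e∉v (↭.∈-resp-↭ (vedges-≅ (≅v-sym v≅w)) e∈w))
    ... | no _ | no _ = Perm.refl (renameV-≅ f v≅w Pointwise.∷ Pointwise.[])

    local-off-e : ∀ {α β v} → ARule α β v → e ∉ vedges v →
      Der (substFm σ α) (substFm σ β) (out v)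
    local-off-e {α} {β} {v} r e∉v with ∉-++⁻ (uppers v) e∉v
    ... | e∉U , e∉L =
      castDer (substFm-off-e α (subst (e ∉_) (sym (occs-upper r)) e∉U))
              (substFm-off-e β (subst (e ∉_) (sym (occs-lower r)) e∉L))
              (subst (Der _ _) (sym (out-off-e v e∉v)) (ruleDer □ (renameRule f r)))

    outs-off-e : ∀ V → All (λ v → e ∉ vedges v) V → concatMap out V ≡ map (renameV f) V
    outs-off-e [] [] = refl
    outs-off-e (v ∷ V) (e∉v ∷ e∉V) = cong₂ _++_ (out-off-e v e∉v) (outs-off-e V e∉V)

    module Redex (s₁ s₂ : Vertex) (e-below-s₁ : e ∈ lowers s₁) (e-above-s₂ : e ∈ uppers s₂)
      (local₁ : ∀ {α β v} → ARule α β v → v ≅v s₁ → Der (substFm σ α) (substFm σ β) (new (kind v)))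
      (local₂ : ∀ {α β v} → ARule α β v → v ≅v s₂ → Der (substFm σ α) (substFm σ β) (new (kind v)))
      where

      Ls Us : List ℕ
      Ls = lowers s₁ ++ lowers s₂
      Us = uppers s₁ ++ uppers s₂

      replacement : List Vertex
      replacement = new (kind s₁) ++ new (kind s₂)

      e∈s₁ : e ∈ vedges s₁
      e∈s₁ = ∈-++⁺ʳ (uppers s₁) e-below-s₁

      e∈s₂ : e ∈ vedges s₂
      e∈s₂ = ∈-++⁺ˡ e-above-s₂

      -- the vertices Φ may contain: those off e, and the redex vertices
      Good : Vertex → Set
      Good v = e ∉ vedges v ⊎ (v ≅v s₁ ⊎ v ≅v s₂)

      Good-≅ : ∀ {v w} → v ≅v w → Good v → Good w
      Good-≅ v≅w (inj₁ e∉v) = inj₁ (λ e∈w → e∉v (↭.∈-resp-↭ (vedges-≅ (≅v-sym v≅w)) e∈w))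
      Good-≅ v≅w (inj₂ (inj₁ v≅s₁)) = inj₂ (inj₁ (≅v-trans (≅v-sym v≅w) v≅s₁))
      Good-≅ v≅w (inj₂ (inj₂ v≅s₂)) = inj₂ (inj₂ (≅v-trans (≅v-sym v≅w) v≅s₂))

      local : ∀ {α β v} → ARule α β v → Good v → Der (substFm σ α) (substFm σ β) (out v)
      local r (inj₁ e∉v) = local-off-e r e∉v
      local {v = v} r (inj₂ (inj₁ v≅s₁)) = subst (Der _ _)
        (sym (out-on-e v (↭.∈-resp-↭ (vedges-≅ (≅v-sym v≅s₁)) e∈s₁))) (local₁ r v≅s₁)
      local {v = v} r (inj₂ (inj₂ v≅s₂)) = subst (Der _ _)
        (sym (out-on-e v (↭.∈-resp-↭ (vedges-≅ (≅v-sym v≅s₂)) e∈s₂))) (local₂ r v≅s₂)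

      open SubstDer σ out Good local

      -- by tracedness, e has no ends besides its two redex ends
      e-only-in-redex : ∀ {X Y} → Balanced (Ls ++ X) (Us ++ Y) → e ∉ X × e ∉ Y
      e-only-in-redex (L-unique , U↭L) =
        unique-disjoint Ls L-unique (∈-++⁺ˡ e-below-s₁) ,
        unique-disjoint Us (unique-↭ (↭-sym U↭L) L-unique) (∈-++⁺ʳ (uppers s₁) e-above-s₂)

      good-vertices : ∀ {V vs} → All (λ v → e ∉ vedges v) V → vs ≈V s₁ ∷ s₂ ∷ V → All Good vs
      good-vertices e∉V vs≈ = ↭ₛ.All-resp-↭ vertexSetoid Good-≅ (≈V-sym vs≈)
        (inj₂ (inj₁ same) ∷ inj₂ (inj₂ same) ∷ All.map inj₁ e∉V)

      replaced-vertices : ∀ {V vs} → All (λ v → e ∉ vedges v) V → vs ≈V s₁ ∷ s₂ ∷ V →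
        concatMap out vs ≈V replacement ++ map (renameV f) V
      replaced-vertices {V} e∉V vs≈ = Perm.trans (concatMap⁺ vertexSetoid out out-≅ vs≈)
        (≈V-reflexive (trans (cong₂ (λ xs ys → xs ++ ys ++ concatMap out V) (out-on-e s₁ e∈s₁) (out-on-e s₂ e∈s₂))
          (trans (cong (λ ws → new (kind s₁) ++ new (kind s₂) ++ ws) (outs-off-e V e∉V))
            (sym (++-assoc (new (kind s₁)) (new (kind s₂)) _)))))

      replaced-ends : (h : Vertex → List ℕ) → (∀ {v w} → v ≅v w → h v ↭ h w) →
        (∀ f v → h (renameV f v) ≡ map f (h v)) →
        ∀ {R′ ws} R V → R′ ≡ map f R → ws ≈V replacement ++ map (renameV f) V →
        R′ ++ concatMap h ws ↭ concatMap h replacement ++ map f (concatMap h V ++ R)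
      replaced-ends h h-≅ h-rename R V refl ws≈ = ↭-trans
        (↭.++⁺ˡ (map f R) (↭-trans (edgeList-↭ h h-≅ ws≈) (↭-reflexive
          (trans (concatMap-++ h replacement _) (cong (concatMap h replacement ++_) (edgeList-rename h h-rename f V))))))
        (↭-trans (↭.++-comm (map f R) (concatMap h replacement ++ _)) (↭-reflexive
          (trans (++-assoc (concatMap h replacement) _ (map f R))
            (cong (concatMap h replacement ++_) (sym (map-++ f (concatMap h V) R))))))

      occs-contracted : ∀ α → e ∉ occs α → occs (substFm σ α) ≡ map f (occs α)
      occs-contracted α e∉α = trans (cong occs (substFm-off-e α e∉α)) (occs-renameFm f α)

      erase-contracted : ∀ α → e ∉ occs α → erase (substFm σ α) ≡ erase α
      erase-contracted α e∉α = trans (cong erase (substFm-off-e α e∉α)) (erase-renameFm f α)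

      contract : ∀ {T B V} D →
        Bookkeeping (edges ⟨ T , B , s₁ ∷ s₂ ∷ V ⟩) f Ls Us (lowerEdges replacement) (upperEdges replacement) →
        map f T ↭ top D → map f B ↭ bot D → replacement ++ map (renameV f) V ≈V verts D →
        Sound ⟨ T , B , s₁ ∷ s₂ ∷ V ⟩ D
      contract {T} {B} {V} D bookkeeping T↭ B↭ verts↭ {P} {Q} {vs} Φ traced ≈C@(P↭T , Q↭B , vs≈) =
        substFm σ P , substFm σ Q , concatMap out vs , substDer Φ (good-vertices e∉V vs≈) ,
        erase-contracted P e∉P , erase-contracted Q e∉Q ,
        balanced-↭ (↭-sym (replaced-ends lowers lowers-≅ lowers-renameV (occs P) V (occs-contracted P e∉P) replaced))
                   (↭-sym (replaced-ends uppers uppers-≅ uppers-renameV (occs Q) V (occs-contracted Q e∉Q) replaced))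
                   (bookkeeping _ _ LsX⊆E balanced) ,
        ↭-trans (↭-reflexive (occs-contracted P e∉P)) (↭-trans (↭.map⁺ f P↭T) T↭) ,
        ↭-trans (↭-reflexive (occs-contracted Q e∉Q)) (↭-trans (↭.map⁺ f Q↭B) B↭) ,
        Perm.trans replaced verts↭
        where
        balanced = redexBalanced s₁ s₂ Φ traced ≈C
        e∉X = proj₁ (e-only-in-redex balanced)
        e∉Y = proj₂ (e-only-in-redex balanced)
        e∉P = proj₂ (∉-++⁻ (lowerEdges V) e∉X)
        e∉Q = proj₂ (∉-++⁻ (upperEdges V) e∉Y)
        e∉V = avoiding V (proj₁ (∉-++⁻ (upperEdges V) e∉Y)) (proj₁ (∉-++⁻ (lowerEdges V) e∉X))
        replaced = replaced-vertices e∉V vs≈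
        LsX⊆E : Ls ++ (lowerEdges V ++ occs P) ⊆ edges ⟨ T , B , s₁ ∷ s₂ ∷ V ⟩
        LsX⊆E n∈ = lowerEnds⊆edges Φ ≈C
          (↭.∈-resp-↭ (↭-sym (redexEnds lowers lowers-≅ s₁ s₂ V (occs P) vs≈)) n∈)

unrenamed : ∀ (xs : List ℕ) → map (λ n → n) xs ↭ xs
unrenamed xs = ↭-reflexive (map-id xs)

unrenamed-vertices : ∀ {N W} V → N ≈V W → N ++ map (renameV (λ n → n)) V ≈V W ++ V
unrenamed-vertices V N≈W =
  ↭ₛ.++⁺ vertexSetoid N≈W (≈V-reflexive (trans (map-cong renameV-id V) (map-id V)))

module WeakeningCoweakening (e : ℕ) where
  open Contract e (λ n → n) (λ _ → 𝕗)
  open Replace (λ _ → [])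

  at-weakening : ∀ {α β v} → ARule α β v → v ≅v aw↓ e → Der (substFm σ α) (substFm σ β) []
  at-weakening (aw↓ a _) same = castDer refl (σ-on-e a) []

  at-coweakening : ∀ {α β v} → ARule α β v → v ≅v aw↑ e → Der (substFm σ α) (substFm σ β) []
  at-coweakening (aw↑ a _) same = castDer (σ-on-e a) refl 𝕗⇒𝕥

  open Redex (aw↓ e) (aw↑ e) (here refl) (here refl) at-weakening at-coweakening

  sound : ∀ T B V → Sound ⟨ T , B , aw↓ e ∷ aw↑ e ∷ V ⟩ ⟨ T , B , V ⟩
  sound T B V = contract ⟨ T , B , V ⟩
    (bookkeeping-fresh [] [] [] ↭-refl ↭-refl ↭-refl ↭-refl [] [])
    (unrenamed T) (unrenamed B) (unrenamed-vertices V (≈V-reflexive refl))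

-- w↓-i↑: a weakened atom a meets ā (on y) in a cointeraction; on e, a ↦ 𝕗,
-- and ā is coweakened instead.
module WeakeningCointeraction (e y : ℕ) (y≢e : y ≢ e) where
  open Contract e (λ n → n) (λ _ → 𝕗)

  new : Kind → List Vertex
  new cointeraction = aw↑ y ∷ []
  new _ = []

  open Replace new

  at-weakening : ∀ {α β v} → ARule α β v → v ≅v aw↓ e → Der (substFm σ α) (substFm σ β) (new (kind v))
  at-weakening (aw↓ a _) same = castDer refl (σ-on-e a) []

  at-cointeraction : ∀ {α β v} → ARule α β v → v ≅v ai↑ e y → Der (substFm σ α) (substFm σ β) (new (kind v))
  at-cointeraction (ai↑ a _ _) same = castDer (cong₂ _∧_ (σ-on-e a) (σ-off-e (bar a) y≢e)) refl
    (ruleDer (𝕗 ∧ᵣ □) (aw↑ (bar a) y) ⨾ linDer □ (eq→ (∧-unit 𝕗)))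
  at-cointeraction (ai↑ a _ _) (ai↑-sw _ _) = castDer (cong₂ _∧_ (σ-off-e a y≢e) (σ-on-e (bar a))) refl
    (ruleDer (□ ∧ₗ 𝕗) (aw↑ a y) ⨾ linDer □ (eq→ (∧-comm 𝕥 𝕗)) ⨾ linDer □ (eq→ (∧-unit 𝕗)))

  open Redex (aw↓ e) (ai↑ e y) (here refl) (here refl) at-weakening at-cointeraction

  sound : ∀ T B V → Sound ⟨ T , B , aw↓ e ∷ ai↑ e y ∷ V ⟩ ⟨ T , B , aw↑ y ∷ V ⟩
  sound T B V = contract ⟨ T , B , aw↑ y ∷ V ⟩
    (bookkeeping-fresh [] (y ∷ []) [] ↭-refl ↭-refl ↭-refl ↭-refl [] [])
    (unrenamed T) (unrenamed B) (unrenamed-vertices V (≈V-reflexive refl))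

-- i↓-w↑: one half of an interaction is coweakened; on e, a ↦ 𝕥, and the
-- other half (on y) is weakened instead.
module InteractionCoweakening (y e : ℕ) (y≢e : y ≢ e) where
  open Contract e (λ n → n) (λ _ → 𝕥)

  new : Kind → List Vertex
  new interaction = aw↓ y ∷ []
  new _ = []

  open Replace new

  at-interaction : ∀ {α β v} → ARule α β v → v ≅v ai↓ y e → Der (substFm σ α) (substFm σ β) (new (kind v))
  at-interaction (ai↓ a _ _) same = castDer refl (cong₂ _∨_ (σ-off-e a y≢e) (σ-on-e (bar a)))
    (linDer □ (eq← (∨-unit 𝕥)) ⨾ ruleDer (𝕥 ∨ᵣ □) (aw↓ a y) ⨾ linDer □ (eq→ (∨-comm 𝕥 (at (a , y)))))
  at-interaction (ai↓ a _ _) (ai↓-sw _ _) = castDer refl (cong₂ _∨_ (σ-on-e a) (σ-off-e (bar a) y≢e))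
    (linDer □ (eq← (∨-unit 𝕥)) ⨾ ruleDer (𝕥 ∨ᵣ □) (aw↓ (bar a) y))

  at-coweakening : ∀ {α β v} → ARule α β v → v ≅v aw↑ e → Der (substFm σ α) (substFm σ β) (new (kind v))
  at-coweakening (aw↑ a _) same = castDer (σ-on-e a) refl []

  open Redex (ai↓ y e) (aw↑ e) (there (here refl)) (here refl) at-interaction at-coweakening

  sound : ∀ T B V → Sound ⟨ T , B , ai↓ y e ∷ aw↑ e ∷ V ⟩ ⟨ T , B , aw↓ y ∷ V ⟩
  sound T B V = contract ⟨ T , B , aw↓ y ∷ V ⟩
    (bookkeeping-fresh (y ∷ []) [] [] (↭-swap y e ↭-refl) ↭-refl ↭-refl ↭-refl [] [])
    (unrenamed T) (unrenamed B) (unrenamed-vertices V (≈V-reflexive refl))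

-- w↓-c↑: a weakened atom is cocontracted; on e, a ↦ 𝕗 = (𝕗 ∧ 𝕗), and
-- both copies (on l₁, l₂) are weakened instead.
module WeakeningCocontraction (e l₁ l₂ : ℕ) (l₁≢e : l₁ ≢ e) (l₂≢e : l₂ ≢ e) where
  open Contract e (λ n → n) (λ _ → 𝕗)

  new : Kind → List Vertex
  new cocontraction = aw↓ l₁ ∷ aw↓ l₂ ∷ []
  new _ = []

  open Replace new

  at-weakening : ∀ {α β v} → ARule α β v → v ≅v aw↓ e → Der (substFm σ α) (substFm σ β) (new (kind v))
  at-weakening (aw↓ a _) same = castDer refl (σ-on-e a) []

  at-cocontraction : ∀ {α β v} → ARule α β v → v ≅v ac↑ e l₁ l₂ → Der (substFm σ α) (substFm σ β) (new (kind v))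
  at-cocontraction (ac↑ a _ _ _) same = castDer (σ-on-e a) (cong₂ _∧_ (σ-off-e a l₁≢e) (σ-off-e a l₂≢e))
    (linDer □ (eq← 𝕗∧𝕗) ⨾ ruleDer (□ ∧ₗ 𝕗) (aw↓ a l₁) ⨾ ruleDer (at (a , l₁) ∧ᵣ □) (aw↓ a l₂))
  at-cocontraction (ac↑ a _ _ _) (ac↑-sw _ _ _) = castDer (σ-on-e a) (cong₂ _∧_ (σ-off-e a l₂≢e) (σ-off-e a l₁≢e))
    (linDer □ (eq← 𝕗∧𝕗) ⨾ ruleDer (𝕗 ∧ᵣ □) (aw↓ a l₁) ⨾ ruleDer (□ ∧ₗ at (a , l₁)) (aw↓ a l₂))

  open Redex (aw↓ e) (ac↑ e l₁ l₂) (here refl) (here refl) at-weakening at-cocontraction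

  sound : ∀ T B V → Sound ⟨ T , B , aw↓ e ∷ ac↑ e l₁ l₂ ∷ V ⟩ ⟨ T , B , aw↓ l₁ ∷ aw↓ l₂ ∷ V ⟩
  sound T B V = contract ⟨ T , B , aw↓ l₁ ∷ aw↓ l₂ ∷ V ⟩
    (bookkeeping-fresh (l₁ ∷ l₂ ∷ []) [] [] ↭-refl ↭-refl ↭-refl ↭-refl [] [])
    (unrenamed T) (unrenamed B) (unrenamed-vertices V (≈V-reflexive refl))

-- c↓-w↑: a contracted atom is coweakened; on e, a ↦ 𝕥 = [𝕥 ∨ 𝕥], and
-- both contracted copies (on u₁, u₂) are coweakened instead.
module ContractionCoweakening (u₁ u₂ e : ℕ) (u₁≢e : u₁ ≢ e) (u₂≢e : u₂ ≢ e) where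
  open Contract e (λ n → n) (λ _ → 𝕥)

  new : Kind → List Vertex
  new contraction = aw↑ u₁ ∷ aw↑ u₂ ∷ []
  new _ = []

  open Replace new

  at-contraction : ∀ {α β v} → ARule α β v → v ≅v ac↓ u₁ u₂ e → Der (substFm σ α) (substFm σ β) (new (kind v))
  at-contraction (ac↓ a _ _ _) same = castDer (cong₂ _∨_ (σ-off-e a u₁≢e) (σ-off-e a u₂≢e)) (σ-on-e a)
    (ruleDer (□ ∨ₗ at (a , u₂)) (aw↑ a u₁) ⨾ ruleDer (𝕥 ∨ᵣ □) (aw↑ a u₂) ⨾ linDer □ (eq→ 𝕥∨𝕥))
  at-contraction (ac↓ a _ _ _) (ac↓-sw _ _ _) = castDer (cong₂ _∨_ (σ-off-e a u₂≢e) (σ-off-e a u₁≢e)) (σ-on-e a)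
    (ruleDer (at (a , u₂) ∨ᵣ □) (aw↑ a u₁) ⨾ ruleDer (□ ∨ₗ 𝕥) (aw↑ a u₂) ⨾ linDer □ (eq→ 𝕥∨𝕥))

  at-coweakening : ∀ {α β v} → ARule α β v → v ≅v aw↑ e → Der (substFm σ α) (substFm σ β) (new (kind v))
  at-coweakening (aw↑ a _) same = castDer (σ-on-e a) refl []

  open Redex (ac↓ u₁ u₂ e) (aw↑ e) (here refl) (here refl) at-contraction at-coweakening

  sound : ∀ T B V → Sound ⟨ T , B , ac↓ u₁ u₂ e ∷ aw↑ e ∷ V ⟩ ⟨ T , B , aw↑ u₁ ∷ aw↑ u₂ ∷ V ⟩
  sound T B V = contract ⟨ T , B , aw↑ u₁ ∷ aw↑ u₂ ∷ V ⟩
    (bookkeeping-fresh [] (u₁ ∷ u₂ ∷ []) [] ↭-refl (↭.shift e (u₁ ∷ u₂ ∷ []) []) ↭-refl ↭-refl [] [])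
    (unrenamed T) (unrenamed B) (unrenamed-vertices V (≈V-reflexive refl))

-- w↓-c↓: a weakened atom is contracted with the atom on x; on e, a ↦ 𝕗,
-- and the contraction's lower edge l is merged into x.
module WeakeningContraction (e x l : ℕ) (x≢e : x ≢ e) (l≢e : l ≢ e) where
  open Contract e (ren l x) (λ _ → 𝕗)
  open Replace (λ _ → [])

  σ-x : ∀ a → σ (a , x) ≡ at (a , x)
  σ-x a = trans (σ-off-e a x≢e) (cong (λ n → at (a , n)) (ren-target l x))

  σ-l : ∀ a → σ (a , l) ≡ at (a , x)
  σ-l a = trans (σ-off-e a l≢e) (cong (λ n → at (a , n)) (ren-hit l x))

  at-weakening : ∀ {α β v} → ARule α β v → v ≅v aw↓ e → Der (substFm σ α) (substFm σ β) []
  at-weakening (aw↓ a _) same = castDer refl (σ-on-e a) []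

  at-contraction : ∀ {α β v} → ARule α β v → v ≅v ac↓ e x l → Der (substFm σ α) (substFm σ β) []
  at-contraction (ac↓ a _ _ _) same = castDer (cong₂ _∨_ (σ-on-e a) (σ-x a)) (σ-l a)
    (linDer □ (eq→ (∨-comm 𝕗 (at (a , x)))) ⨾ linDer □ (eq→ (∨-unit (at (a , x)))))
  at-contraction (ac↓ a _ _ _) (ac↓-sw _ _ _) = castDer (cong₂ _∨_ (σ-x a) (σ-on-e a)) (σ-l a)
    (linDer □ (eq→ (∨-unit (at (a , x)))))

  open Redex (aw↓ e) (ac↓ e x l) (here refl) (here refl) at-weakening at-contraction

  sound : ∀ T B V → Sound ⟨ T , B , aw↓ e ∷ ac↓ e x l ∷ V ⟩ (merge l x T B V)
  sound T B V = contract (merge l x T B V) (bookkeeping-merge l x ↭-refl ↭-refl)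
    ↭-refl ↭-refl (≈V-reflexive (map-cong (renameV-ren l x) V))

-- c↑-w↑: one copy (on e) of a cocontracted atom is coweakened; on e,
-- a ↦ 𝕥, and the other copy's edge y is merged into the upper edge u.
module CocontractionCoweakening (u e y : ℕ) (u≢e : u ≢ e) (y≢e : y ≢ e) where
  open Contract e (ren y u) (λ _ → 𝕥)
  open Replace (λ _ → [])

  σ-u : ∀ a → σ (a , u) ≡ at (a , u)
  σ-u a = trans (σ-off-e a u≢e) (cong (λ n → at (a , n)) (ren-target y u))

  σ-y : ∀ a → σ (a , y) ≡ at (a , u)
  σ-y a = trans (σ-off-e a y≢e) (cong (λ n → at (a , n)) (ren-hit y u))

  at-cocontraction : ∀ {α β v} → ARule α β v → v ≅v ac↑ u e y → Der (substFm σ α) (substFm σ β) []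
  at-cocontraction (ac↑ a _ _ _) same = castDer (σ-u a) (cong₂ _∧_ (σ-on-e a) (σ-y a))
    (linDer □ (eq← (∧-unit (at (a , u)))) ⨾ linDer □ (eq→ (∧-comm (at (a , u)) 𝕥)))
  at-cocontraction (ac↑ a _ _ _) (ac↑-sw _ _ _) = castDer (σ-u a) (cong₂ _∧_ (σ-y a) (σ-on-e a))
    (linDer □ (eq← (∧-unit (at (a , u)))))

  at-coweakening : ∀ {α β v} → ARule α β v → v ≅v aw↑ e → Der (substFm σ α) (substFm σ β) []
  at-coweakening (aw↑ a _) same = castDer (σ-on-e a) refl []

  open Redex (ac↑ u e y) (aw↑ e) (here refl) (here refl) at-cocontraction at-coweakening

  sound : ∀ T B V → Sound ⟨ T , B , ac↑ u e y ∷ aw↑ e ∷ V ⟩ (merge y u T B V)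
  sound T B V = contract (merge y u T B V) (bookkeeping-merge y u ↭-refl (↭-swap u e ↭-refl))
    ↭-refl ↭-refl (≈V-reflexive (map-cong (renameV-ren y u) V))

bar-involutive : ∀ a → bar (bar a) ≡ a
bar-involutive (pos n) = refl
bar-involutive (neg n) = refl

-- The local derivation of c↓-i↑: ([a ∨ a] ∧ ā) ⇒ 𝕗 by cocontracting ā and
-- letting each copy, moved next to one disjunct by a switch, cointeract.
cointeraction-with-disjunction : ∀ a ε₁ ε₂ ε₃ δ₁ δ₂ →
  Der ((at (a , ε₁) ∨ at (a , ε₂)) ∧ at (bar a , ε₃)) 𝕗
      (ac↑ ε₃ δ₁ δ₂ ∷ ai↑ ε₁ δ₁ ∷ ai↑ ε₂ δ₂ ∷ [])
cointeraction-with-disjunction a ε₁ ε₂ ε₃ δ₁ δ₂ =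
  ruleDer (a₁∨a₂ ∧ᵣ □) (ac↑ (bar a) ε₃ δ₁ δ₂)
  ⨾ linDer □ (eq→ (∧-comm a₁∨a₂ (b₁ ∧ b₂)))
  ⨾ linDer □ (eq→ (∧-assoc b₁ b₂ a₁∨a₂))
  ⨾ linDer (b₁ ∧ᵣ (b₂ ∧ᵣ □)) (eq→ (∨-comm a₁ a₂))
  ⨾ linDer (b₁ ∧ᵣ □) (switch b₂ a₂ a₁)
  ⨾ linDer (b₁ ∧ᵣ □) (eq→ (∨-comm (b₂ ∧ a₂) a₁))
  ⨾ linDer □ (switch b₁ a₁ (b₂ ∧ a₂))
  ⨾ linDer (□ ∨ₗ (b₂ ∧ a₂)) (eq→ (∧-comm b₁ a₁))
  ⨾ ruleDer (□ ∨ₗ (b₂ ∧ a₂)) (ai↑ a ε₁ δ₁)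
  ⨾ linDer (𝕗 ∨ᵣ □) (eq→ (∧-comm b₂ a₂))
  ⨾ ruleDer (𝕗 ∨ᵣ □) (ai↑ a ε₂ δ₂)
  ⨾ linDer □ (eq→ (∨-unit 𝕗))
  where
  a₁ a₂ b₁ b₂ a₁∨a₂ : LFm
  a₁ = at (a , ε₁)
  a₂ = at (a , ε₂)
  b₁ = at (bar a , δ₁)
  b₂ = at (bar a , δ₂)
  a₁∨a₂ = a₁ ∨ a₂

-- The local derivation of i↓-c↑, dually: 𝕥 ⇒ [(a ∧ a) ∨ ā] by two
-- interactions, two switches, and a contraction of the two copies of ā.
interaction-with-conjunction : ∀ a ε₁ ε₂ ε₃ δ₁ δ₂ →
  Der 𝕥 ((at (a , ε₁) ∧ at (a , ε₂)) ∨ at (bar a , ε₃))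
      (ai↓ ε₁ δ₁ ∷ ai↓ ε₂ δ₂ ∷ ac↓ δ₁ δ₂ ε₃ ∷ [])
interaction-with-conjunction a ε₁ ε₂ ε₃ δ₁ δ₂ =
  linDer □ (eq← (∧-unit 𝕥))
  ⨾ ruleDer (□ ∧ₗ 𝕥) (ai↓ a ε₁ δ₁)
  ⨾ ruleDer (a₁∨b₁ ∧ᵣ □) (ai↓ a ε₂ δ₂)
  ⨾ linDer □ (switch a₁∨b₁ a₂ b₂)
  ⨾ linDer (□ ∨ₗ b₂) (eq→ (∧-comm a₁∨b₁ a₂))
  ⨾ linDer (□ ∨ₗ b₂) (switch a₂ a₁ b₁)
  ⨾ linDer □ (eq→ (∨-assoc (a₂ ∧ a₁) b₁ b₂))
  ⨾ ruleDer ((a₂ ∧ a₁) ∨ᵣ □) (ac↓ (bar a) δ₁ δ₂ ε₃)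
  ⨾ linDer (□ ∨ₗ at (bar a , ε₃)) (eq→ (∧-comm a₂ a₁))
  where
  a₁ a₂ b₁ b₂ a₁∨b₁ : LFm
  a₁ = at (a , ε₁)
  a₂ = at (a , ε₂)
  b₁ = at (bar a , δ₁)
  b₂ = at (bar a , δ₂)
  a₁∨b₁ = a₁ ∨ b₁

-- The local derivation of c↓-c↑: [a ∨ a] ⇒ (a ∧ a) by cocontracting both
-- disjuncts, one medial, and contracting the copies pairwise.
medial-exchange : ∀ a ε₁ ε₂ ε₃ ε₄ δ₁ δ₂ δ₃ δ₄ →
  Der (at (a , ε₁) ∨ at (a , ε₂)) (at (a , ε₃) ∧ at (a , ε₄))
      (ac↑ ε₁ δ₁ δ₂ ∷ ac↑ ε₂ δ₃ δ₄ ∷ ac↓ δ₁ δ₃ ε₃ ∷ ac↓ δ₂ δ₄ ε₄ ∷ [])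
medial-exchange a ε₁ ε₂ ε₃ ε₄ δ₁ δ₂ δ₃ δ₄ =
  ruleDer (□ ∨ₗ at (a , ε₂)) (ac↑ a ε₁ δ₁ δ₂)
  ⨾ ruleDer ((d₁ ∧ d₂) ∨ᵣ □) (ac↑ a ε₂ δ₃ δ₄)
  ⨾ linDer □ (medial d₁ d₂ d₃ d₄)
  ⨾ ruleDer (□ ∧ₗ (d₂ ∨ d₄)) (ac↓ a δ₁ δ₃ ε₃)
  ⨾ ruleDer (at (a , ε₃) ∧ᵣ □) (ac↓ a δ₂ δ₄ ε₄)
  where
  d₁ d₂ d₃ d₄ : LFm
  d₁ = at (a , δ₁)
  d₂ = at (a , δ₂)
  d₃ = at (a , δ₃)
  d₄ = at (a , δ₄)

-- c↓-i↑: a contracted atom meets ā (on ε₃) in a cointeraction; on e,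
-- a ↦ [a ∨ a] with the contraction's upper edges ε₁, ε₂.
module ContractionCointeraction (ε₁ ε₂ ε₃ e δ₁ δ₂ : ℕ) (ε₁≢e : ε₁ ≢ e) (ε₂≢e : ε₂ ≢ e) (ε₃≢e : ε₃ ≢ e) where
  G : Atom → LFm
  G a = at (a , ε₁) ∨ at (a , ε₂)

  open Contract e (λ n → n) G

  new : Kind → List Vertex
  new cointeraction = ac↑ ε₃ δ₁ δ₂ ∷ ai↑ ε₁ δ₁ ∷ ai↑ ε₂ δ₂ ∷ []
  new _ = []

  open Replace new

  at-contraction : ∀ {α β v} → ARule α β v → v ≅v ac↓ ε₁ ε₂ e → Der (substFm σ α) (substFm σ β) (new (kind v))
  at-contraction (ac↓ a _ _ _) same = castDer (cong₂ _∨_ (σ-off-e a ε₁≢e) (σ-off-e a ε₂≢e)) (σ-on-e a) []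
  at-contraction (ac↓ a _ _ _) (ac↓-sw _ _ _) = castDer (cong₂ _∨_ (σ-off-e a ε₂≢e) (σ-off-e a ε₁≢e)) (σ-on-e a)
    (linDer □ (eq→ (∨-comm (at (a , ε₂)) (at (a , ε₁)))))

  at-cointeraction : ∀ {α β v} → ARule α β v → v ≅v ai↑ e ε₃ → Der (substFm σ α) (substFm σ β) (new (kind v))
  at-cointeraction (ai↑ a _ _) same = castDer (cong₂ _∧_ (σ-on-e a) (σ-off-e (bar a) ε₃≢e)) refl
    (cointeraction-with-disjunction a ε₁ ε₂ ε₃ δ₁ δ₂)
  at-cointeraction (ai↑ a _ _) (ai↑-sw _ _) = castDer (cong₂ _∧_ (σ-off-e a ε₃≢e) (σ-on-e (bar a))) refl
    (linDer □ (eq→ (∧-comm (at (a , ε₃)) (G (bar a))))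
     ⨾ subst (λ b → Der (G (bar a) ∧ at (b , ε₃)) 𝕗 _) (bar-involutive a)
         (cointeraction-with-disjunction (bar a) ε₁ ε₂ ε₃ δ₁ δ₂))

  open Redex (ac↓ ε₁ ε₂ e) (ai↑ e ε₃) (here refl) (here refl) at-contraction at-cointeraction

  sound : ∀ T B V → let C = ⟨ T , B , ac↓ ε₁ ε₂ e ∷ ai↑ e ε₃ ∷ V ⟩ in
    δ₁ ∉ edges C → δ₂ ∉ edges C → δ₁ ≢ δ₂ → Sound C ⟨ T , B , ac↑ ε₃ δ₁ δ₂ ∷ ai↑ ε₁ δ₁ ∷ ai↑ ε₂ δ₂ ∷ V ⟩
  sound T B V δ₁-fresh δ₂-fresh δ₁≢δ₂ = contract _
    (bookkeeping-fresh [] (ε₁ ∷ ε₂ ∷ ε₃ ∷ []) (δ₁ ∷ δ₂ ∷ [])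
      ↭-refl (↭.shift e (ε₁ ∷ ε₂ ∷ []) (ε₃ ∷ [])) ↭-refl new-uppers
      ((δ₁≢δ₂ ∷ []) ∷ [] ∷ []) (δ₁-fresh ∷ δ₂-fresh ∷ []))
    (unrenamed T) (unrenamed B) (unrenamed-vertices V (≈V-reflexive refl))
    where
    new-uppers : ε₃ ∷ ε₁ ∷ δ₁ ∷ ε₂ ∷ δ₂ ∷ [] ↭ δ₁ ∷ δ₂ ∷ ε₁ ∷ ε₂ ∷ ε₃ ∷ []
    new-uppers = ↭-trans (↭.shift δ₁ (ε₃ ∷ ε₁ ∷ []) (ε₂ ∷ δ₂ ∷ []))
      (↭-prep δ₁ (↭-trans (↭.shift δ₂ (ε₃ ∷ ε₁ ∷ ε₂ ∷ []) [])
        (↭-prep δ₂ (↭-sym (↭.shift ε₃ (ε₁ ∷ ε₂ ∷ []) [])))))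

-- i↓-c↑: one half (on e) of an interaction is cocontracted; on e,
-- a ↦ (a ∧ a) with the cocontraction's lower edges ε₁, ε₂.
module InteractionCocontraction (ε₁ ε₂ ε₃ e δ₁ δ₂ : ℕ) (ε₁≢e : ε₁ ≢ e) (ε₂≢e : ε₂ ≢ e) (ε₃≢e : ε₃ ≢ e) where
  G : Atom → LFm
  G a = at (a , ε₁) ∧ at (a , ε₂)

  open Contract e (λ n → n) G

  new : Kind → List Vertex
  new interaction = ai↓ ε₁ δ₁ ∷ ai↓ ε₂ δ₂ ∷ ac↓ δ₁ δ₂ ε₃ ∷ []
  new _ = []

  open Replace new

  at-interaction : ∀ {α β v} → ARule α β v → v ≅v ai↓ ε₃ e → Der (substFm σ α) (substFm σ β) (new (kind v))
  at-interaction (ai↓ a _ _) same = castDer refl (cong₂ _∨_ (σ-off-e a ε₃≢e) (σ-on-e (bar a)))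
    (subst (λ b → Der 𝕥 (G (bar a) ∨ at (b , ε₃)) _) (bar-involutive a)
       (interaction-with-conjunction (bar a) ε₁ ε₂ ε₃ δ₁ δ₂)
     ⨾ linDer □ (eq→ (∨-comm (G (bar a)) (at (a , ε₃)))))
  at-interaction (ai↓ a _ _) (ai↓-sw _ _) = castDer refl (cong₂ _∨_ (σ-on-e a) (σ-off-e (bar a) ε₃≢e))
    (interaction-with-conjunction a ε₁ ε₂ ε₃ δ₁ δ₂)

  at-cocontraction : ∀ {α β v} → ARule α β v → v ≅v ac↑ e ε₁ ε₂ → Der (substFm σ α) (substFm σ β) (new (kind v))
  at-cocontraction (ac↑ a _ _ _) same = castDer (σ-on-e a) (cong₂ _∧_ (σ-off-e a ε₁≢e) (σ-off-e a ε₂≢e)) []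
  at-cocontraction (ac↑ a _ _ _) (ac↑-sw _ _ _) = castDer (σ-on-e a) (cong₂ _∧_ (σ-off-e a ε₂≢e) (σ-off-e a ε₁≢e))
    (linDer □ (eq→ (∧-comm (at (a , ε₁)) (at (a , ε₂)))))

  open Redex (ai↓ ε₃ e) (ac↑ e ε₁ ε₂) (there (here refl)) (here refl) at-interaction at-cocontraction

  sound : ∀ T B V → let C = ⟨ T , B , ai↓ ε₃ e ∷ ac↑ e ε₁ ε₂ ∷ V ⟩ in
    δ₁ ∉ edges C → δ₂ ∉ edges C → δ₁ ≢ δ₂ → Sound C ⟨ T , B , ac↓ δ₁ δ₂ ε₃ ∷ ai↓ ε₁ δ₁ ∷ ai↓ ε₂ δ₂ ∷ V ⟩
  sound T B V δ₁-fresh δ₂-fresh δ₁≢δ₂ = contract _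
    (bookkeeping-fresh (ε₁ ∷ ε₂ ∷ ε₃ ∷ []) [] (δ₁ ∷ δ₂ ∷ [])
      redex-lowers ↭-refl new-lowers ↭-refl
      ((δ₁≢δ₂ ∷ []) ∷ [] ∷ []) (δ₁-fresh ∷ δ₂-fresh ∷ []))
    (unrenamed T) (unrenamed B) (unrenamed-vertices V contraction-first)
    where
    redex-lowers : ε₃ ∷ e ∷ ε₁ ∷ ε₂ ∷ [] ↭ e ∷ ε₁ ∷ ε₂ ∷ ε₃ ∷ []
    redex-lowers = ↭-trans (↭-swap ε₃ e ↭-refl) (↭-prep e (↭-sym (↭.shift ε₃ (ε₁ ∷ ε₂ ∷ []) [])))
    new-lowers : ε₁ ∷ δ₁ ∷ ε₂ ∷ δ₂ ∷ ε₃ ∷ [] ↭ δ₁ ∷ δ₂ ∷ ε₁ ∷ ε₂ ∷ ε₃ ∷ []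
    new-lowers = ↭-trans (↭.shift δ₁ (ε₁ ∷ []) (ε₂ ∷ δ₂ ∷ ε₃ ∷ []))
      (↭-prep δ₁ (↭.shift δ₂ (ε₁ ∷ ε₂ ∷ []) (ε₃ ∷ [])))
    contraction-first : ai↓ ε₁ δ₁ ∷ ai↓ ε₂ δ₂ ∷ ac↓ δ₁ δ₂ ε₃ ∷ [] ≈V ac↓ δ₁ δ₂ ε₃ ∷ ai↓ ε₁ δ₁ ∷ ai↓ ε₂ δ₂ ∷ []
    contraction-first = Perm.trans (Perm.prep same (Perm.swap same same (≈V-reflexive refl)))
      (Perm.swap same same (≈V-reflexive refl))

-- c↓-c↑: a contraction followed by a cocontraction; on e, a ↦ [a ∨ a]
-- with the contraction's upper edges ε₁, ε₂.
module ContractionCocontraction (ε₁ ε₂ ε₃ ε₄ e δ₁ δ₂ δ₃ δ₄ : ℕ)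
  (ε₁≢e : ε₁ ≢ e) (ε₂≢e : ε₂ ≢ e) (ε₃≢e : ε₃ ≢ e) (ε₄≢e : ε₄ ≢ e) where
  open Contract e (λ n → n) (λ a → at (a , ε₁) ∨ at (a , ε₂))

  new : Kind → List Vertex
  new cocontraction = ac↑ ε₁ δ₁ δ₂ ∷ ac↑ ε₂ δ₃ δ₄ ∷ ac↓ δ₁ δ₃ ε₃ ∷ ac↓ δ₂ δ₄ ε₄ ∷ []
  new _ = []

  open Replace new

  at-contraction : ∀ {α β v} → ARule α β v → v ≅v ac↓ ε₁ ε₂ e → Der (substFm σ α) (substFm σ β) (new (kind v))
  at-contraction (ac↓ a _ _ _) same = castDer (cong₂ _∨_ (σ-off-e a ε₁≢e) (σ-off-e a ε₂≢e)) (σ-on-e a) []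
  at-contraction (ac↓ a _ _ _) (ac↓-sw _ _ _) = castDer (cong₂ _∨_ (σ-off-e a ε₂≢e) (σ-off-e a ε₁≢e)) (σ-on-e a)
    (linDer □ (eq→ (∨-comm (at (a , ε₂)) (at (a , ε₁)))))

  at-cocontraction : ∀ {α β v} → ARule α β v → v ≅v ac↑ e ε₃ ε₄ → Der (substFm σ α) (substFm σ β) (new (kind v))
  at-cocontraction (ac↑ a _ _ _) same = castDer (σ-on-e a) (cong₂ _∧_ (σ-off-e a ε₃≢e) (σ-off-e a ε₄≢e))
    (medial-exchange a ε₁ ε₂ ε₃ ε₄ δ₁ δ₂ δ₃ δ₄)
  at-cocontraction (ac↑ a _ _ _) (ac↑-sw _ _ _) = castDer (σ-on-e a) (cong₂ _∧_ (σ-off-e a ε₄≢e) (σ-off-e a ε₃≢e))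
    (medial-exchange a ε₁ ε₂ ε₃ ε₄ δ₁ δ₂ δ₃ δ₄ ⨾ linDer □ (eq→ (∧-comm (at (a , ε₃)) (at (a , ε₄)))))

  open Redex (ac↓ ε₁ ε₂ e) (ac↑ e ε₃ ε₄) (here refl) (here refl) at-contraction at-cocontraction

  sound : ∀ T B V → let C = ⟨ T , B , ac↓ ε₁ ε₂ e ∷ ac↑ e ε₃ ε₄ ∷ V ⟩ in
    Unique (δ₁ ∷ δ₂ ∷ δ₃ ∷ δ₄ ∷ []) → δ₁ ∉ edges C → δ₂ ∉ edges C → δ₃ ∉ edges C → δ₄ ∉ edges C →
    Sound C ⟨ T , B , ac↑ ε₁ δ₁ δ₂ ∷ ac↑ ε₂ δ₃ δ₄ ∷ ac↓ δ₁ δ₃ ε₃ ∷ ac↓ δ₂ δ₄ ε₄ ∷ V ⟩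
  sound T B V δs-distinct δ₁-fresh δ₂-fresh δ₃-fresh δ₄-fresh = contract _
    (bookkeeping-fresh (ε₃ ∷ ε₄ ∷ []) (ε₁ ∷ ε₂ ∷ []) (δ₁ ∷ δ₂ ∷ δ₃ ∷ δ₄ ∷ [])
      ↭-refl (↭.shift e (ε₁ ∷ ε₂ ∷ []) []) ↭-refl new-uppers
      δs-distinct (δ₁-fresh ∷ δ₂-fresh ∷ δ₃-fresh ∷ δ₄-fresh ∷ []))
    (unrenamed T) (unrenamed B) (unrenamed-vertices V (≈V-reflexive refl))
    where
    new-uppers : ε₁ ∷ ε₂ ∷ δ₁ ∷ δ₃ ∷ δ₂ ∷ δ₄ ∷ [] ↭ δ₁ ∷ δ₂ ∷ δ₃ ∷ δ₄ ∷ ε₁ ∷ ε₂ ∷ []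
    new-uppers = ↭-trans (↭.shifts (ε₁ ∷ ε₂ ∷ []) (δ₁ ∷ δ₃ ∷ δ₂ ∷ δ₄ ∷ []) {[]})
      (↭-prep δ₁ (↭-swap δ₃ δ₂ ↭-refl))

-- Each rule is sound.  The only hypotheses of the rule modules besides
-- freshness are that the redex edges other than e differ from e, which
-- tracedness of Φ provides (redexDistinct).

w↓-w↑-sound : ∀ T B V e → Sound ⟨ T , B , aw↓ e ∷ aw↑ e ∷ V ⟩ ⟨ T , B , V ⟩
w↓-w↑-sound T B V e = WeakeningCoweakening.sound e T B V

w↓-i↑-sound : ∀ T B V e y → Sound ⟨ T , B , aw↓ e ∷ ai↑ e y ∷ V ⟩ ⟨ T , B , aw↑ y ∷ V ⟩
w↓-i↑-sound T B V e y Φ t ≈C with redexDistinct (aw↓ e) (ai↑ e y) Φ t ≈C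
... | _ , (e≢y ∷ []) ∷ _ = WeakeningCointeraction.sound e y (≢-sym e≢y) T B V Φ t ≈C

i↓-w↑-sound : ∀ T B V y e → Sound ⟨ T , B , ai↓ y e ∷ aw↑ e ∷ V ⟩ ⟨ T , B , aw↓ y ∷ V ⟩
i↓-w↑-sound T B V y e Φ t ≈C with redexDistinct (ai↓ y e) (aw↑ e) Φ t ≈C
... | (y≢e ∷ []) ∷ _ , _ = InteractionCoweakening.sound y e y≢e T B V Φ t ≈C

w↓-c↑-sound : ∀ T B V e l₁ l₂ →
  Sound ⟨ T , B , aw↓ e ∷ ac↑ e l₁ l₂ ∷ V ⟩ ⟨ T , B , aw↓ l₁ ∷ aw↓ l₂ ∷ V ⟩
w↓-c↑-sound T B V e l₁ l₂ Φ t ≈C with redexDistinct (aw↓ e) (ac↑ e l₁ l₂) Φ t ≈C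
... | (e≢l₁ ∷ e≢l₂ ∷ []) ∷ _ , _ =
  WeakeningCocontraction.sound e l₁ l₂ (≢-sym e≢l₁) (≢-sym e≢l₂) T B V Φ t ≈C

c↓-w↑-sound : ∀ T B V u₁ u₂ e →
  Sound ⟨ T , B , ac↓ u₁ u₂ e ∷ aw↑ e ∷ V ⟩ ⟨ T , B , aw↑ u₁ ∷ aw↑ u₂ ∷ V ⟩
c↓-w↑-sound T B V u₁ u₂ e Φ t ≈C with redexDistinct (ac↓ u₁ u₂ e) (aw↑ e) Φ t ≈C
... | _ , (_ ∷ u₁≢e ∷ []) ∷ (u₂≢e ∷ []) ∷ _ = ContractionCoweakening.sound u₁ u₂ e u₁≢e u₂≢e T B V Φ t ≈C

w↓-c↓-sound : ∀ T B V e x l → Sound ⟨ T , B , aw↓ e ∷ ac↓ e x l ∷ V ⟩ (merge l x T B V)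
w↓-c↓-sound T B V e x l Φ t ≈C with redexDistinct (aw↓ e) (ac↓ e x l) Φ t ≈C
... | (e≢l ∷ []) ∷ _ , (e≢x ∷ []) ∷ _ =
  WeakeningContraction.sound e x l (≢-sym e≢x) (≢-sym e≢l) T B V Φ t ≈C

c↑-w↑-sound : ∀ T B V u e y → Sound ⟨ T , B , ac↑ u e y ∷ aw↑ e ∷ V ⟩ (merge y u T B V)
c↑-w↑-sound T B V u e y Φ t ≈C with redexDistinct (ac↑ u e y) (aw↑ e) Φ t ≈C
... | (e≢y ∷ []) ∷ _ , (u≢e ∷ []) ∷ _ = CocontractionCoweakening.sound u e y u≢e (≢-sym e≢y) T B V Φ t ≈C

c↓-i↑-sound : ∀ T B V ε₁ ε₂ ε₃ e δ₁ δ₂ → let C = ⟨ T , B , ac↓ ε₁ ε₂ e ∷ ai↑ e ε₃ ∷ V ⟩ in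
  δ₁ ∉ edges C → δ₂ ∉ edges C → δ₁ ≢ δ₂ → Sound C ⟨ T , B , ac↑ ε₃ δ₁ δ₂ ∷ ai↑ ε₁ δ₁ ∷ ai↑ ε₂ δ₂ ∷ V ⟩
c↓-i↑-sound T B V ε₁ ε₂ ε₃ e δ₁ δ₂ δ₁-fresh δ₂-fresh δ₁≢δ₂ Φ t ≈C
  with redexDistinct (ac↓ ε₁ ε₂ e) (ai↑ e ε₃) Φ t ≈C
... | _ , (_ ∷ ε₁≢e ∷ _) ∷ (ε₂≢e ∷ _) ∷ (e≢ε₃ ∷ []) ∷ _ =
  ContractionCointeraction.sound ε₁ ε₂ ε₃ e δ₁ δ₂ ε₁≢e ε₂≢e (≢-sym e≢ε₃) T B V δ₁-fresh δ₂-fresh δ₁≢δ₂ Φ t ≈C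

i↓-c↑-sound : ∀ T B V ε₁ ε₂ ε₃ e δ₁ δ₂ → let C = ⟨ T , B , ai↓ ε₃ e ∷ ac↑ e ε₁ ε₂ ∷ V ⟩ in
  δ₁ ∉ edges C → δ₂ ∉ edges C → δ₁ ≢ δ₂ → Sound C ⟨ T , B , ac↓ δ₁ δ₂ ε₃ ∷ ai↓ ε₁ δ₁ ∷ ai↓ ε₂ δ₂ ∷ V ⟩
i↓-c↑-sound T B V ε₁ ε₂ ε₃ e δ₁ δ₂ δ₁-fresh δ₂-fresh δ₁≢δ₂ Φ t ≈C
  with redexDistinct (ai↓ ε₃ e) (ac↑ e ε₁ ε₂) Φ t ≈C
... | (ε₃≢e ∷ _) ∷ (e≢ε₁ ∷ e≢ε₂ ∷ []) ∷ _ , _ =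
  InteractionCocontraction.sound ε₁ ε₂ ε₃ e δ₁ δ₂ (≢-sym e≢ε₁) (≢-sym e≢ε₂) ε₃≢e T B V δ₁-fresh δ₂-fresh δ₁≢δ₂ Φ t ≈C

c↓-c↑-sound : ∀ T B V ε₁ ε₂ ε₃ ε₄ e δ₁ δ₂ δ₃ δ₄ → let C = ⟨ T , B , ac↓ ε₁ ε₂ e ∷ ac↑ e ε₃ ε₄ ∷ V ⟩ in
  Unique (δ₁ ∷ δ₂ ∷ δ₃ ∷ δ₄ ∷ []) → δ₁ ∉ edges C → δ₂ ∉ edges C → δ₃ ∉ edges C → δ₄ ∉ edges C →
  Sound C ⟨ T , B , ac↑ ε₁ δ₁ δ₂ ∷ ac↑ ε₂ δ₃ δ₄ ∷ ac↓ δ₁ δ₃ ε₃ ∷ ac↓ δ₂ δ₄ ε₄ ∷ V ⟩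
c↓-c↑-sound T B V ε₁ ε₂ ε₃ ε₄ e δ₁ δ₂ δ₃ δ₄ δs-distinct δ₁-fresh δ₂-fresh δ₃-fresh δ₄-fresh Φ t ≈C
  with redexDistinct (ac↓ ε₁ ε₂ e) (ac↑ e ε₃ ε₄) Φ t ≈C
... | (e≢ε₃ ∷ e≢ε₄ ∷ []) ∷ _ , (_ ∷ ε₁≢e ∷ []) ∷ (ε₂≢e ∷ []) ∷ _ =
  ContractionCocontraction.sound ε₁ ε₂ ε₃ ε₄ e δ₁ δ₂ δ₃ δ₄ ε₁≢e ε₂≢e (≢-sym e≢ε₃) (≢-sym e≢ε₄) T B V
    δs-distinct δ₁-fresh δ₂-fresh δ₃-fresh δ₄-fresh Φ t ≈C

theorem4p8 : (r : RRule) {C D : Flow} → C ⟶[ r ] D →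
    ∀ {P Q : LFm} {vs : List Vertex} (Φ : Der P Q vs) → Traced Φ → flowOf Φ ≈F C →
    Σ LFm λ P′ → Σ LFm λ Q′ → Σ (List Vertex) λ ws → Σ (Der P′ Q′ ws) λ Ψ →
      erase P′ ≡ erase P × erase Q′ ≡ erase Q × Traced Ψ × flowOf Ψ ≈F D
theorem4p8 w↓-w↑ (r-w↓-w↑ T B V e) = w↓-w↑-sound T B V e
theorem4p8 w↓-i↑ (r-w↓-i↑ T B V e y) = w↓-i↑-sound T B V e y
theorem4p8 i↓-w↑ (r-i↓-w↑ T B V y e) = i↓-w↑-sound T B V y e
theorem4p8 w↓-c↑ (r-w↓-c↑ T B V e l₁ l₂) = w↓-c↑-sound T B V e l₁ l₂
theorem4p8 c↓-w↑ (r-c↓-w↑ T B V u₁ u₂ e) = c↓-w↑-sound T B V u₁ u₂ e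
theorem4p8 w↓-c↓ (r-w↓-c↓ T B V e x l) = w↓-c↓-sound T B V e x l
theorem4p8 c↑-w↑ (r-c↑-w↑ T B V u e y) = c↑-w↑-sound T B V u e y
theorem4p8 c↓-i↑ (r-c↓-i↑ T B V ε₁ ε₂ ε₃ e δ₁ δ₂ δ₁-fresh δ₂-fresh δ₁≢δ₂) =
  c↓-i↑-sound T B V ε₁ ε₂ ε₃ e δ₁ δ₂ δ₁-fresh δ₂-fresh δ₁≢δ₂
theorem4p8 i↓-c↑ (r-i↓-c↑ T B V ε₁ ε₂ ε₃ e δ₁ δ₂ δ₁-fresh δ₂-fresh δ₁≢δ₂) =
  i↓-c↑-sound T B V ε₁ ε₂ ε₃ e δ₁ δ₂ δ₁-fresh δ₂-fresh δ₁≢δ₂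
theorem4p8 c↓-c↑ (r-c↓-c↑ T B V ε₁ ε₂ ε₃ ε₄ e δ₁ δ₂ δ₃ δ₄ δs-distinct δ₁-fresh δ₂-fresh δ₃-fresh δ₄-fresh) =
  c↓-c↑-sound T B V ε₁ ε₂ ε₃ ε₄ e δ₁ δ₂ δ₃ δ₄ δs-distinct δ₁-fresh δ₂-fresh δ₃-fresh δ₄-fresh
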